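{- As formal power series in $q$, \[ (-q;q)_\infty = \sum_{n\geq k\geq 0} q^{(2n+1)n + 3k}\, Y_{q^2}(2n+1-k,k)\,(q^2;q^2)_{2n+1}^{ -1}\,[2(n-k)+2]_q . \]
   Context: $(a;q)_k=\prod_{j=0}^{k-1}(1-aq^j)$, $(a;q)_0=1$, $(a;q)_\infty=\prod_{j\ge0}(1-aq^j)$ (and likewise with base $q^2$). For $m\ge 0$: $[m]_q=1+q+\cdots+q^{m-1}$, $[m]_q!=[m]_q[m-1]_q\cdots[1]_q$, and for $m\ge j\ge 0$, $\begin{bmatrix} m\\ j\end{bmatrix}_q=\frac{[m]_q!}{[j]_q![m-j]_q!}$. For $m\ge j\ge 0$ the $q$-Yamanouchi number is $Y_q(m,j)=\frac{[m-j+1]_q}{[m+1]_q}\begin{bmatrix} m+j\\ m\end{bmatrix}_q$; $Y_{q^2}$ denotes this with $q$ replaced by $q^2$. -}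

module Defs where

open import Data.Nat using (ℕ; zero; suc; _≡ᵇ_; _∸_) renaming (_+_ to _+ℕ_; _*_ to _*ℕ_)
open import Data.Integer using (ℤ; +_; -_; _+_; _*_; _-_; 0ℤ; 1ℤ)
open import Data.List using (List; []; _∷_; map; foldr; upTo; zipWith)
open import Data.Bool using (if_then_else_)

-- Formal power series in q with integer coefficients: n ↦ coefficient of q^n.
FPS : Set
FPS = ℕ → ℤ

sumℤ : List ℤ → ℤ
sumℤ = foldr _+_ 0ℤ

mono : ℕ → FPS
mono e n = if n ≡ᵇ e then 1ℤ else 0ℤ

one : FPS
one = mono 0

infixl 6 _⊕_ _⊖_
infixl 7 _⊗_

_⊕_ : FPS → FPS → FPS
(a ⊕ b) n = a n + b n

_⊖_ : FPS → FPS → FPS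
(a ⊖ b) n = a n - b n

_⊗_ : FPS → FPS → FPS
(a ⊗ b) n = sumℤ (map (λ i → a i * b (n ∸ i)) (upTo (suc n)))

prodL : List FPS → FPS
prodL = foldr _⊗_ one

sumL : List FPS → FPS
sumL = foldr _⊕_ (λ _ → 0ℤ)

-- Multiplicative inverse of a series with constant term 1 (all series
-- inverted below have constant term 1).  invRev a n = [b_n, ..., b_0]
-- where b = a⁻¹, via b_0 = 1, b_{n+1} = - Σ_{i=1}^{n+1} a_i b_{n+1-i}.
invRev : FPS → ℕ → List ℤ
invRev a zero = 1ℤ ∷ []
invRev a (suc n) =
  (- sumℤ (zipWith _*_ (map (λ i → a (suc i)) (upTo (suc n))) (invRev a n)))
    ∷ invRev a n

headℤ : List ℤ → ℤ
headℤ [] = 0ℤ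
headℤ (x ∷ _) = x

inv : FPS → FPS
inv a n = headℤ (invRev a n)

-- q-analogues in base q^d (d = 1 gives base q, d = 2 gives base q^2).
-- [m]_{q^d} = 1 + q^d + ... + q^{d(m-1)}
qint : ℕ → ℕ → FPS
qint d m = sumL (map (λ i → mono (d *ℕ i)) (upTo m))

qfact : ℕ → ℕ → FPS
qfact d m = prodL (map (λ i → qint d (suc i)) (upTo m))

-- q-binomial [m choose j]_{q^d} = [m]! / ([j]! [m-j]!)   (used with m ≥ j)
qbinom : ℕ → ℕ → ℕ → FPS
qbinom d m j = qfact d m ⊗ inv (qfact d j ⊗ qfact d (m ∸ j))

-- q-Yamanouchi number Y_{q^d}(m,j) = [m-j+1]/[m+1] * [m+j choose m]  (m ≥ j)
qYam : ℕ → ℕ → ℕ → FPS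
qYam d m j = qint d (suc (m ∸ j)) ⊗ inv (qint d (suc m)) ⊗ qbinom d (m +ℕ j) m

poch : FPS → ℕ → ℕ → FPS
poch a d k = prodL (map (λ j → one ⊖ a ⊗ mono (d *ℕ j)) (upTo k))

negate : FPS → FPS
negate a n = - a n

term : ℕ → ℕ → FPS
term n k =
  mono ((2 *ℕ n +ℕ 1) *ℕ n +ℕ 3 *ℕ k)
  ⊗ qYam 2 (2 *ℕ n +ℕ 1 ∸ k) k
  ⊗ inv (poch (mono 2) 2 (2 *ℕ n +ℕ 1))
  ⊗ qint 1 (2 *ℕ (n ∸ k) +ℕ 2)

rhsPartial : ℕ → FPS
rhsPartial M = sumL (map (λ n → sumL (map (λ k → term n k) (upTo (suc n)))) (upTo (suc M)))

lhsPartial : ℕ → FPS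
lhsPartial M = poch (negate (mono 1)) 1 M

-- Expand the left side by Euler: (-q;q)_∞ = Σ_m q^(m(m+1)/2)/(q;q)_m.  The terms m = 2n and
-- m = 2n+1 add up to q^((2n+1)n)/(q;q)_(2n+1), so it suffices that the n-th inner sum on the right
-- equals this.  As (q²;q²)_N = (q;q)_N (-q;q)_N, that is the finite identity
--   Σ_{k≤n} q^(3k) Y_{q²}(N−k, k) [2(n−k)+2]_q = (-q;q)_N,   N = 2n+1,
-- which follows by writing Y as a difference of two Gaussian binomials and reducing everything to
-- Gauss's identity Σ_k q^k [N choose k]_{q²} = (-q;q)_N.  Coefficientwise, the infinite sums are
-- handled by truncation: 1/(q;q)_m agrees with [m+r choose m]_q up to degree r.

module Submission where

open import Defs
open import Algebra.Bundles using (CommutativeMonoid; CommutativeRing)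
import Algebra.Properties.CommutativeSemigroup as CommSemigroupProps
import Algebra.Solver.Ring
import Algebra.Solver.Ring.AlmostCommutativeRing as AlmostCommutativeRing
open import Data.Bool using (if_then_else_)
import Data.Integer as ℤ
import Data.Integer.Properties as ℤP
import Data.Integer.Tactic.RingSolver as ℤSolver
open import Data.List using (_∷_; map; upTo; zipWith; applyUpTo)
open import Data.Maybe using (Maybe; just; nothing)
open import Data.Nat using (ℕ; zero; suc; _∸_; _≤_; _<_; z≤n; s≤s; _≡ᵇ_) renaming (_+_ to _+ℕ_; _*_ to _*ℕ_)
import Data.Nat.Properties as ℕP
import Data.Nat.Tactic.RingSolver as ℕSolver
open import Data.Product using (_,_)
open import Function using (id)
open import Relation.Binary.PropositionalEquality as ≡ using (_≡_)
open import Relation.Nullary using (yes; no)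
import Relation.Binary.Reasoning.Setoid as SetoidReasoning

module BigOp {c ℓ} (M : CommutativeMonoid c ℓ) where
  open CommutativeMonoid M
  open SetoidReasoning setoid
  open CommSemigroupProps commutativeSemigroup using (interchange)

  big : (ℕ → Carrier) → ℕ → Carrier
  big f zero = ε
  big f (suc m) = f 0 ∙ big (λ i → f (suc i)) m

  big-cong< : ∀ {f g} m → (∀ i → i < m → f i ≈ g i) → big f m ≈ big g m
  big-cong< zero e = refl
  big-cong< (suc m) e = ∙-cong (e 0 (s≤s z≤n)) (big-cong< m (λ i p → e (suc i) (s≤s p)))

  big-cong : ∀ {f g} m → (∀ i → f i ≈ g i) → big f m ≈ big g m
  big-cong m e = big-cong< m (λ i _ → e i)

  big-ε : ∀ {f} m → (∀ i → f i ≈ ε) → big f m ≈ ε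
  big-ε zero e = refl
  big-ε (suc m) e = trans (∙-cong (e 0) (big-ε m (λ i → e (suc i)))) (identityˡ ε)

  big-split : ∀ f a b → big f (a +ℕ b) ≈ big f a ∙ big (λ i → f (a +ℕ i)) b
  big-split f zero b = sym (identityˡ _)
  big-split f (suc a) b = trans (∙-cong refl (big-split (λ i → f (suc i)) a b)) (sym (assoc (f 0) _ _))

  big-snoc : ∀ f m → big f (suc m) ≈ big f m ∙ f m
  big-snoc f m = begin
    big f (suc m)               ≡⟨ ≡.cong (big f) (ℕP.+-comm 1 m) ⟩
    big f (m +ℕ 1)              ≈⟨ big-split f m 1 ⟩
    big f m ∙ (f (m +ℕ 0) ∙ ε)  ≈⟨ ∙-cong refl (identityʳ _) ⟩
    big f m ∙ f (m +ℕ 0)        ≡⟨ ≡.cong (λ j → big f m ∙ f j) (ℕP.+-identityʳ m) ⟩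
    big f m ∙ f m               ∎

  big-∙ : ∀ f g m → big (λ i → f i ∙ g i) m ≈ big f m ∙ big g m
  big-∙ f g zero = sym (identityˡ ε)
  big-∙ f g (suc m) =
    trans (∙-cong refl (big-∙ (λ i → f (suc i)) (λ i → g (suc i)) m)) (interchange (f 0) (g 0) _ _)

  big-reverse : ∀ f m → big f m ≈ big (λ i → f (m ∸ suc i)) m
  big-reverse f zero = refl
  big-reverse f (suc m) = begin
    f 0 ∙ big (λ i → f (suc i)) m             ≈⟨ ∙-cong refl (big-reverse (λ i → f (suc i)) m) ⟩
    f 0 ∙ big (λ i → f (suc (m ∸ suc i))) m   ≈⟨ comm _ _ ⟩
    big (λ i → f (suc (m ∸ suc i))) m ∙ f 0   ≈⟨ ∙-cong (big-cong< m (λ i p → reflexive (≡.cong f (≡.sym (ℕP.+-∸-assoc 1 p))))) refl ⟩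
    big (λ i → f (m ∸ i)) m ∙ f 0             ≡⟨ ≡.cong (λ j → big (λ i → f (m ∸ i)) m ∙ f j) (≡.sym (ℕP.n∸n≡0 m)) ⟩
    big (λ i → f (m ∸ i)) m ∙ f (m ∸ m)       ≈⟨ sym (big-snoc (λ i → f (m ∸ i)) m) ⟩
    big (λ i → f (m ∸ i)) (suc m)             ∎

  big-fold : ∀ f m → big f (m +ℕ m) ≈ big (λ i → f i ∙ f (m +ℕ m ∸ suc i)) m
  big-fold f m = begin
    big f (m +ℕ m)                                          ≈⟨ big-split f m m ⟩
    big f m ∙ big (λ i → f (m +ℕ i)) m                       ≈⟨ ∙-cong refl (big-reverse (λ i → f (m +ℕ i)) m) ⟩
    big f m ∙ big (λ i → f (m +ℕ (m ∸ suc i))) m             ≈⟨ ∙-cong refl (big-cong< m (λ i i<m → reflexive (≡.cong f (≡.sym (ℕP.+-∸-assoc m i<m))))) ⟩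
    big f m ∙ big (λ i → f (m +ℕ m ∸ suc i)) m               ≈⟨ sym (big-∙ f (λ i → f (m +ℕ m ∸ suc i)) m) ⟩
    big (λ i → f i ∙ f (m +ℕ m ∸ suc i)) m                   ∎

  big-pairs : ∀ f m → big f (m +ℕ m) ≈ big (λ i → f (i +ℕ i) ∙ f (suc (i +ℕ i))) m
  big-pairs f zero = refl
  big-pairs f (suc m) = begin
    f 0 ∙ big (λ i → f (suc i)) (m +ℕ suc m)                     ≡⟨ ≡.cong (λ j → f 0 ∙ big (λ i → f (suc i)) j) (ℕP.+-suc m m) ⟩
    f 0 ∙ (f 1 ∙ big (λ i → f (2 +ℕ i)) (m +ℕ m))                ≈⟨ sym (assoc (f 0) (f 1) _) ⟩
    (f 0 ∙ f 1) ∙ big (λ i → f (2 +ℕ i)) (m +ℕ m)                ≈⟨ ∙-cong refl (big-pairs (λ i → f (2 +ℕ i)) m) ⟩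
    (f 0 ∙ f 1) ∙ big (λ i → f (2 +ℕ (i +ℕ i)) ∙ f (3 +ℕ (i +ℕ i))) m
                                                                 ≈⟨ ∙-cong refl (big-cong m (λ i → reflexive (≡.cong₂ (λ j k → f j ∙ f k) (shift i) (≡.cong suc (shift i))))) ⟩
    (f 0 ∙ f 1) ∙ big (λ i → f (suc i +ℕ suc i) ∙ f (suc (suc i +ℕ suc i))) m ∎
    where
    shift : ∀ i → 2 +ℕ (i +ℕ i) ≡ suc i +ℕ suc i
    shift i = ≡.cong suc (≡.sym (ℕP.+-suc i i))

module BigSum {c ℓ} (R : CommutativeRing c ℓ) where
  open CommutativeRing R
  open BigOp +-commutativeMonoid public
  open SetoidReasoning setoid
  open import Algebra.Properties.Ring ring using (-0#≈0#; -‿+-comm)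

  big-*ˡ : ∀ x f m → big (λ i → x * f i) m ≈ x * big f m
  big-*ˡ x f zero = sym (zeroʳ x)
  big-*ˡ x f (suc m) = trans (+-cong refl (big-*ˡ x (λ i → f (suc i)) m)) (sym (distribˡ x (f 0) _))

  big-neg : ∀ f m → big (λ i → - f i) m ≈ - big f m
  big-neg f zero = sym -0#≈0#
  big-neg f (suc m) = trans (+-cong refl (big-neg (λ i → f (suc i)) m)) (-‿+-comm (f 0) _)

  big-− : ∀ f g m → big (λ i → f i - g i) m ≈ big f m - big g m
  big-− f g m = trans (big-∙ f (λ i → - g i) m) (+-cong refl (big-neg g m))

open ≡ using (refl; sym; trans; cong; cong₂; subst)
open ℤ using (ℤ; -_; _+_; _*_; _-_; 0ℤ; 1ℤ)

module ℤΣ = BigSum ℤP.+-*-commutativeRing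

∑ℤ : (ℕ → ℤ) → ℕ → ℤ
∑ℤ = ℤΣ.big

sumℤ-map-applyUpTo : ∀ (g : ℕ → ℤ) (f : ℕ → ℕ) m → sumℤ (map g (applyUpTo f m)) ≡ ∑ℤ (λ i → g (f i)) m
sumℤ-map-applyUpTo g f zero = refl
sumℤ-map-applyUpTo g f (suc m) = cong (g (f 0) +_) (sumℤ-map-applyUpTo g (λ i → f (suc i)) m)

infix 4 _≋_
_≋_ : FPS → FPS → Set
a ≋ b = ∀ n → a n ≡ b n

zeroS : FPS
zeroS _ = 0ℤ

tail : FPS → FPS
tail a n = a (suc n)

scale : ℤ → FPS → FPS
scale s a n = s * a n

coeff-⊗ : ∀ a b n → (a ⊗ b) n ≡ ∑ℤ (λ i → a i * b (n ∸ i)) (suc n)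
coeff-⊗ a b n = sumℤ-map-applyUpTo (λ i → a i * b (n ∸ i)) id (suc n)

coeff₀-⊗ : ∀ a b → (a ⊗ b) 0 ≡ a 0 * b 0
coeff₀-⊗ a b = ℤP.+-identityʳ (a 0 * b 0)

tail-⊗ : ∀ a b n → (a ⊗ b) (suc n) ≡ a 0 * b (suc n) + (tail a ⊗ b) n
tail-⊗ a b n = trans (coeff-⊗ a b (suc n)) (cong (a 0 * b (suc n) +_) (sym (coeff-⊗ (tail a) b n)))

⊗-cong : ∀ {a a′ b b′} → a ≋ a′ → b ≋ b′ → a ⊗ b ≋ a′ ⊗ b′
⊗-cong {a} {a′} {b} {b′} p q n = begin
  (a ⊗ b) n                                   ≡⟨ coeff-⊗ a b n ⟩
  ∑ℤ (λ i → a i * b (n ∸ i)) (suc n)          ≡⟨ ℤΣ.big-cong (suc n) (λ i → cong₂ _*_ (p i) (q (n ∸ i))) ⟩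
  ∑ℤ (λ i → a′ i * b′ (n ∸ i)) (suc n)        ≡⟨ sym (coeff-⊗ a′ b′ n) ⟩
  (a′ ⊗ b′) n                                 ∎
  where open ≡.≡-Reasoning

⊗-comm : ∀ a b → a ⊗ b ≋ b ⊗ a
⊗-comm a b n = begin
  (a ⊗ b) n                                           ≡⟨ coeff-⊗ a b n ⟩
  ∑ℤ (λ i → a i * b (n ∸ i)) (suc n)                  ≡⟨ ℤΣ.big-reverse (λ i → a i * b (n ∸ i)) (suc n) ⟩
  ∑ℤ (λ i → a (n ∸ i) * b (n ∸ (n ∸ i))) (suc n)      ≡⟨ ℤΣ.big-cong< (suc n) swap ⟩
  ∑ℤ (λ i → b i * a (n ∸ i)) (suc n)                  ≡⟨ sym (coeff-⊗ b a n) ⟩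
  (b ⊗ a) n                                           ∎
  where
  open ≡.≡-Reasoning
  swap : ∀ i → i < suc n → a (n ∸ i) * b (n ∸ (n ∸ i)) ≡ b i * a (n ∸ i)
  swap i (s≤s i≤n) = trans (cong (λ j → a (n ∸ i) * b j) (ℕP.m∸[m∸n]≡n i≤n)) (ℤP.*-comm (a (n ∸ i)) (b i))

⊗-distribˡ : ∀ a b c → a ⊗ (b ⊕ c) ≋ a ⊗ b ⊕ a ⊗ c
⊗-distribˡ a b c n = begin
  (a ⊗ (b ⊕ c)) n                                                        ≡⟨ coeff-⊗ a (b ⊕ c) n ⟩
  ∑ℤ (λ i → a i * (b (n ∸ i) + c (n ∸ i))) (suc n)                        ≡⟨ ℤΣ.big-cong {g = λ i → a i * b (n ∸ i) + a i * c (n ∸ i)} (suc n) (λ i → ℤP.*-distribˡ-+ (a i) _ _) ⟩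
  ∑ℤ (λ i → a i * b (n ∸ i) + a i * c (n ∸ i)) (suc n)                    ≡⟨ ℤΣ.big-∙ (λ i → a i * b (n ∸ i)) (λ i → a i * c (n ∸ i)) (suc n) ⟩
  ∑ℤ (λ i → a i * b (n ∸ i)) (suc n) + ∑ℤ (λ i → a i * c (n ∸ i)) (suc n) ≡⟨ sym (cong₂ _+_ (coeff-⊗ a b n) (coeff-⊗ a c n)) ⟩
  (a ⊗ b ⊕ a ⊗ c) n                                                      ∎
  where open ≡.≡-Reasoning

⊗-distribʳ : ∀ a b c → (b ⊕ c) ⊗ a ≋ b ⊗ a ⊕ c ⊗ a
⊗-distribʳ a b c n =
  trans (⊗-comm (b ⊕ c) a n) (trans (⊗-distribˡ a b c n) (cong₂ _+_ (⊗-comm a b n) (⊗-comm a c n)))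

scale-⊗ : ∀ s a b → scale s a ⊗ b ≋ scale s (a ⊗ b)
scale-⊗ s a b n = begin
  (scale s a ⊗ b) n                          ≡⟨ coeff-⊗ (scale s a) b n ⟩
  ∑ℤ (λ i → s * a i * b (n ∸ i)) (suc n)     ≡⟨ ℤΣ.big-cong {g = λ i → s * (a i * b (n ∸ i))} (suc n) (λ i → ℤP.*-assoc s (a i) _) ⟩
  ∑ℤ (λ i → s * (a i * b (n ∸ i))) (suc n)   ≡⟨ ℤΣ.big-*ˡ s (λ i → a i * b (n ∸ i)) (suc n) ⟩
  s * ∑ℤ (λ i → a i * b (n ∸ i)) (suc n)     ≡⟨ cong (s *_) (sym (coeff-⊗ a b n)) ⟩
  s * (a ⊗ b) n                              ∎
  where open ≡.≡-Reasoning

-- By induction on the degree, through  tail (a ⊗ b) = a 0 · tail b + tail a ⊗ b.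
⊗-assoc : ∀ a b c → (a ⊗ b) ⊗ c ≋ a ⊗ (b ⊗ c)
⊗-assoc a b c zero = begin
  ((a ⊗ b) ⊗ c) 0      ≡⟨ coeff₀-⊗ (a ⊗ b) c ⟩
  (a ⊗ b) 0 * c 0      ≡⟨ cong (_* c 0) (coeff₀-⊗ a b) ⟩
  a 0 * b 0 * c 0      ≡⟨ ℤP.*-assoc (a 0) (b 0) (c 0) ⟩
  a 0 * (b 0 * c 0)    ≡⟨ cong (a 0 *_) (sym (coeff₀-⊗ b c)) ⟩
  a 0 * (b ⊗ c) 0      ≡⟨ sym (coeff₀-⊗ a (b ⊗ c)) ⟩
  (a ⊗ (b ⊗ c)) 0      ∎
  where open ≡.≡-Reasoning
⊗-assoc a b c (suc n) = begin
  ((a ⊗ b) ⊗ c) (suc n)                                               ≡⟨ tail-⊗ (a ⊗ b) c n ⟩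
  (a ⊗ b) 0 * c (suc n) + (tail (a ⊗ b) ⊗ c) n                        ≡⟨ cong₂ _+_ (cong (_* c (suc n)) (coeff₀-⊗ a b)) (⊗-cong {b = c} {b′ = c} (tail-⊗ a b) (λ _ → refl) n) ⟩
  a 0 * b 0 * c (suc n) + ((scale (a 0) (tail b) ⊕ tail a ⊗ b) ⊗ c) n  ≡⟨ cong (a 0 * b 0 * c (suc n) +_) (⊗-distribʳ c (scale (a 0) (tail b)) (tail a ⊗ b) n) ⟩
  a 0 * b 0 * c (suc n) + ((scale (a 0) (tail b) ⊗ c) n + ((tail a ⊗ b) ⊗ c) n)
                                                                      ≡⟨ cong (a 0 * b 0 * c (suc n) +_) (cong₂ _+_ (scale-⊗ (a 0) (tail b) c n) (⊗-assoc (tail a) b c n)) ⟩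
  a 0 * b 0 * c (suc n) + (a 0 * (tail b ⊗ c) n + (tail a ⊗ (b ⊗ c)) n) ≡⟨ regroup (a 0) (b 0) (c (suc n)) _ _ ⟩
  a 0 * (b 0 * c (suc n) + (tail b ⊗ c) n) + (tail a ⊗ (b ⊗ c)) n      ≡⟨ cong (λ x → a 0 * x + (tail a ⊗ (b ⊗ c)) n) (sym (tail-⊗ b c n)) ⟩
  a 0 * (b ⊗ c) (suc n) + (tail a ⊗ (b ⊗ c)) n                        ≡⟨ sym (tail-⊗ a (b ⊗ c) n) ⟩
  (a ⊗ (b ⊗ c)) (suc n)                                               ∎
  where
  open ≡.≡-Reasoning
  regroup : ∀ p q r s t → p * q * r + (p * s + t) ≡ p * (q * r + s) + t
  regroup = ℤSolver.solve-∀

⊗-identityˡ : ∀ a → one ⊗ a ≋ a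
⊗-identityˡ a zero = trans (coeff₀-⊗ one a) (ℤP.*-identityˡ (a 0))
⊗-identityˡ a (suc n) = begin
  (one ⊗ a) (suc n)                    ≡⟨ tail-⊗ one a n ⟩
  1ℤ * a (suc n) + (zeroS ⊗ a) n       ≡⟨ cong₂ _+_ (ℤP.*-identityˡ (a (suc n))) (coeff-⊗ zeroS a n) ⟩
  a (suc n) + ∑ℤ (λ i → 0ℤ * a (n ∸ i)) (suc n) ≡⟨ cong (a (suc n) +_) (ℤΣ.big-ε {f = λ i → 0ℤ * a (n ∸ i)} (suc n) (λ i → ℤP.*-zeroˡ (a (n ∸ i)))) ⟩
  a (suc n) + 0ℤ                       ≡⟨ ℤP.+-identityʳ (a (suc n)) ⟩
  a (suc n)                            ∎
  where open ≡.≡-Reasoning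

FPS-commutativeRing : CommutativeRing _ _
FPS-commutativeRing = record
  { Carrier = FPS ; _≈_ = _≋_ ; _+_ = _⊕_ ; _*_ = _⊗_ ; -_ = negate ; 0# = zeroS ; 1# = one
  ; isCommutativeRing = record
    { isRing = record
      { +-isAbelianGroup = record
        { isGroup = record
          { isMonoid = record
            { isSemigroup = record
              { isMagma = record
                { isEquivalence = record { refl = λ _ → refl ; sym = λ p n → sym (p n) ; trans = λ p q n → trans (p n) (q n) }
                ; ∙-cong = λ p q n → cong₂ _+_ (p n) (q n) }
              ; assoc = λ a b c n → ℤP.+-assoc (a n) (b n) (c n) }
            ; identity = (λ a n → ℤP.+-identityˡ (a n)) , (λ a n → ℤP.+-identityʳ (a n)) }
          ; inverse = (λ a n → ℤP.+-inverseˡ (a n)) , (λ a n → ℤP.+-inverseʳ (a n))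
          ; ⁻¹-cong = λ p n → cong -_ (p n) }
        ; comm = λ a b n → ℤP.+-comm (a n) (b n) }
      ; *-cong = ⊗-cong
      ; *-assoc = ⊗-assoc
      ; *-identity = ⊗-identityˡ , (λ a n → trans (⊗-comm a one n) (⊗-identityˡ a n))
      ; distrib = ⊗-distribˡ , ⊗-distribʳ }
    ; *-comm = ⊗-comm } }

module FPS = CommutativeRing FPS-commutativeRing
module ≋-Reasoning = SetoidReasoning FPS.setoid
module ⊕-Props = CommSemigroupProps FPS.+-commutativeSemigroup
module ⊗-Props = CommSemigroupProps FPS.*-commutativeSemigroup
open import Algebra.Properties.Ring FPS.ring using (-‿distribˡ-*)

-- With this embedding, con 1ℤ is definitionally the series one.
constant : ℤ → FPS
constant k n = if n ≡ᵇ 0 then k else 0ℤ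

constant-scale : ∀ k → constant k ≋ scale k one
constant-scale k zero = sym (ℤP.*-identityʳ k)
constant-scale k (suc n) = sym (ℤP.*-zeroʳ k)

constant-homomorphism : CommutativeRing.rawRing ℤP.+-*-commutativeRing AlmostCommutativeRing.-Raw-AlmostCommutative⟶ AlmostCommutativeRing.fromCommutativeRing FPS-commutativeRing
constant-homomorphism = record
  { ⟦_⟧ = constant
  ; +-homo = λ { a b zero → refl ; a b (suc n) → refl }
  ; *-homo = λ a b → begin
      constant (a * b)              ≈⟨ constant-scale (a * b) ⟩
      scale (a * b) one             ≈⟨ (λ n → ℤP.*-assoc a b (one n)) ⟩
      scale a (scale b one)         ≈⟨ (λ n → cong (a *_) (sym (⊗-identityˡ (scale b one) n))) ⟩
      scale a (one ⊗ scale b one)   ≈⟨ FPS.sym (scale-⊗ a one (scale b one)) ⟩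
      scale a one ⊗ scale b one     ≈⟨ FPS.sym (⊗-cong (constant-scale a) (constant-scale b)) ⟩
      constant a ⊗ constant b       ∎
  ; -‿homo = λ { a zero → refl ; a (suc n) → refl }
  ; 0-homo = λ { zero → refl ; (suc n) → refl }
  ; 1-homo = λ { zero → refl ; (suc n) → refl } }
  where open ≋-Reasoning

constant-≟ : ∀ a b → Maybe (constant a ≋ constant b)
constant-≟ a b with a ℤ.≟ b
... | yes refl = just FPS.refl
... | no _ = nothing

open Algebra.Solver.Ring (CommutativeRing.rawRing ℤP.+-*-commutativeRing)
  (AlmostCommutativeRing.fromCommutativeRing FPS-commutativeRing) constant-homomorphism constant-≟
  using (solve; _:=_; _:+_; _:*_; _:-_; :-_; con)

⊕-cong : ∀ {a a′ b b′} → a ≋ a′ → b ≋ b′ → a ⊕ b ≋ a′ ⊕ b′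
⊕-cong = FPS.+-cong

⊕-congˡ : ∀ {a a′} b → a ≋ a′ → a ⊕ b ≋ a′ ⊕ b
⊕-congˡ b p n = cong (_+ b n) (p n)

⊕-congʳ : ∀ a {b b′} → b ≋ b′ → a ⊕ b ≋ a ⊕ b′
⊕-congʳ a p n = cong (a n +_) (p n)

⊖-cong : ∀ {a a′ b b′} → a ≋ a′ → b ≋ b′ → a ⊖ b ≋ a′ ⊖ b′
⊖-cong p q n = cong₂ _-_ (p n) (q n)

⊖-congˡ : ∀ {a a′} b → a ≋ a′ → a ⊖ b ≋ a′ ⊖ b
⊖-congˡ b p n = cong (_- b n) (p n)

⊖-congʳ : ∀ a {b b′} → b ≋ b′ → a ⊖ b ≋ a ⊖ b′
⊖-congʳ a p n = cong (λ x → a n - x) (p n)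

⊗-congˡ : ∀ {a a′} b → a ≋ a′ → a ⊗ b ≋ a′ ⊗ b
⊗-congˡ {a} {a′} b p = ⊗-cong {a} {a′} {b} {b} p (λ _ → refl)

⊗-congʳ : ∀ a {b b′} → b ≋ b′ → a ⊗ b ≋ a ⊗ b′
⊗-congʳ a {b} {b′} p = ⊗-cong {a} {a} {b} {b′} (λ _ → refl) p

module ΣS = BigSum FPS-commutativeRing
module ΠS = BigOp FPS.*-commutativeMonoid

Σs : (ℕ → FPS) → ℕ → FPS
Σs = ΣS.big

Πs : (ℕ → FPS) → ℕ → FPS
Πs = ΠS.big

coeff-Σs : ∀ f m n → Σs f m n ≡ ∑ℤ (λ i → f i n) m
coeff-Σs f zero n = refl
coeff-Σs f (suc m) n = cong (f 0 n +_) (coeff-Σs (λ i → f (suc i)) m n)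

sumL-map-applyUpTo : ∀ (g : ℕ → FPS) (f : ℕ → ℕ) m → sumL (map g (applyUpTo f m)) ≋ Σs (λ i → g (f i)) m
sumL-map-applyUpTo g f zero n = refl
sumL-map-applyUpTo g f (suc m) n = cong (g (f 0) n +_) (sumL-map-applyUpTo g (λ i → f (suc i)) m n)

prodL-map-applyUpTo : ∀ (g : ℕ → FPS) (f : ℕ → ℕ) m → prodL (map g (applyUpTo f m)) ≋ Πs (λ i → g (f i)) m
prodL-map-applyUpTo g f zero n = refl
prodL-map-applyUpTo g f (suc m) = ⊗-congʳ (g (f 0)) (prodL-map-applyUpTo g (λ i → f (suc i)) m)

shift : FPS → FPS
shift a zero = 0ℤ
shift a (suc n) = a n

mono-cong : ∀ {d e} → d ≡ e → mono d ≋ mono e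
mono-cong refl = FPS.refl

mono-suc-⊗ : ∀ e a → mono (suc e) ⊗ a ≋ shift (mono e ⊗ a)
mono-suc-⊗ e a zero = trans (coeff₀-⊗ (mono (suc e)) a) (ℤP.*-zeroˡ (a 0))
mono-suc-⊗ e a (suc n) = trans (tail-⊗ (mono (suc e)) a n) (trans (cong (_+ (mono e ⊗ a) n) (ℤP.*-zeroˡ (a (suc n)))) (ℤP.+-identityˡ _))

mono-+ : ∀ d e → mono d ⊗ mono e ≋ mono (d +ℕ e)
mono-+ zero e = ⊗-identityˡ (mono e)
mono-+ (suc d) e zero = mono-suc-⊗ d (mono e) zero
mono-+ (suc d) e (suc n) = trans (mono-suc-⊗ d (mono e) (suc n)) (mono-+ d e n)

mono-⊗-assoc : ∀ d e a → mono d ⊗ (mono e ⊗ a) ≋ mono (d +ℕ e) ⊗ a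
mono-⊗-assoc d e a = FPS.trans (FPS.sym (⊗-assoc (mono d) (mono e) a)) (⊗-congˡ a (mono-+ d e))

mono-⊗-below : ∀ e a n → n < e → (mono e ⊗ a) n ≡ 0ℤ
mono-⊗-below (suc e) a zero _ = mono-suc-⊗ e a zero
mono-⊗-below (suc e) a (suc n) (s≤s n<e) = trans (mono-suc-⊗ e a (suc n)) (mono-⊗-below e a n n<e)

record ConstOne (a : FPS) : Set where
  constructor constOne
  field const-one : a 0 ≡ 1ℤ

ConstOne-≋ : ∀ {a b} → a ≋ b → ConstOne a → ConstOne b
ConstOne-≋ p (constOne q) = constOne (trans (sym (p 0)) q)

ConstOne-⊗ : ∀ {a b} → ConstOne a → ConstOne b → ConstOne (a ⊗ b)
ConstOne-⊗ {a} {b} (constOne p) (constOne q) = constOne (trans (coeff₀-⊗ a b) (cong₂ _*_ p q))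

ConstOne-Πs : ∀ {f} m → (∀ i → ConstOne (f i)) → ConstOne (Πs f m)
ConstOne-Πs zero h = constOne refl
ConstOne-Πs (suc m) h = ConstOne-⊗ (h 0) (ConstOne-Πs m (λ i → h (suc i)))

invRev-applyUpTo : ∀ a n → invRev a n ≡ applyUpTo (λ i → inv a (n ∸ i)) (suc n)
invRev-applyUpTo a zero = refl
invRev-applyUpTo a (suc n) = cong (inv a (suc n) ∷_) (invRev-applyUpTo a n)

inv-suc : ∀ a n → inv a (suc n) ≡ - (tail a ⊗ inv a) n
inv-suc a n = cong -_ (begin
  sumℤ (zipWith _*_ (map (λ i → a (suc i)) (upTo (suc n))) (invRev a n))
    ≡⟨ cong (λ l → sumℤ (zipWith _*_ (map (λ i → a (suc i)) (upTo (suc n))) l)) (invRev-applyUpTo a n) ⟩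
  sumℤ (zipWith _*_ (map (λ i → a (suc i)) (upTo (suc n))) (applyUpTo (λ i → inv a (n ∸ i)) (suc n)))
    ≡⟨ zip-sum (λ i → a (suc i)) id (λ i → inv a (n ∸ i)) (suc n) ⟩
  ∑ℤ (λ i → a (suc i) * inv a (n ∸ i)) (suc n)
    ≡⟨ sym (coeff-⊗ (tail a) (inv a) n) ⟩
  (tail a ⊗ inv a) n ∎)
  where
  open ≡.≡-Reasoning
  zip-sum : ∀ g f h m → sumℤ (zipWith _*_ (map g (applyUpTo f m)) (applyUpTo h m)) ≡ ∑ℤ (λ i → g (f i) * h i) m
  zip-sum g f h zero = refl
  zip-sum g f h (suc m) = cong (g (f 0) * h 0 +_) (zip-sum g (λ i → f (suc i)) (λ i → h (suc i)) m)

inv-inverseʳ : ∀ {a} → ConstOne a → a ⊗ inv a ≋ one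
inv-inverseʳ {a} (constOne a₀≡1) zero = trans (coeff₀-⊗ a (inv a)) (cong (_* 1ℤ) a₀≡1)
inv-inverseʳ {a} (constOne a₀≡1) (suc n) = begin
  (a ⊗ inv a) (suc n)                             ≡⟨ tail-⊗ a (inv a) n ⟩
  a 0 * inv a (suc n) + (tail a ⊗ inv a) n        ≡⟨ cong₂ (λ x y → x * y + (tail a ⊗ inv a) n) a₀≡1 (inv-suc a n) ⟩
  1ℤ * - (tail a ⊗ inv a) n + (tail a ⊗ inv a) n  ≡⟨ cong (_+ (tail a ⊗ inv a) n) (ℤP.*-identityˡ (- (tail a ⊗ inv a) n)) ⟩
  - (tail a ⊗ inv a) n + (tail a ⊗ inv a) n       ≡⟨ ℤP.+-inverseˡ ((tail a ⊗ inv a) n) ⟩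
  0ℤ                                              ∎
  where open ≡.≡-Reasoning

inv-inverseˡ : ∀ {a} → ConstOne a → inv a ⊗ a ≋ one
inv-inverseˡ {a} c = FPS.trans (⊗-comm (inv a) a) (inv-inverseʳ c)

⊗-cancelʳ : ∀ {a} b c → ConstOne a → b ⊗ a ≋ c ⊗ a → b ≋ c
⊗-cancelʳ {a} b c u e = begin
  b                  ≈⟨ FPS.sym (FPS.*-identityʳ b) ⟩
  b ⊗ one            ≈⟨ ⊗-congʳ b (FPS.sym (inv-inverseʳ u)) ⟩
  b ⊗ (a ⊗ inv a)    ≈⟨ FPS.sym (⊗-assoc b a (inv a)) ⟩
  (b ⊗ a) ⊗ inv a    ≈⟨ ⊗-congˡ (inv a) e ⟩
  (c ⊗ a) ⊗ inv a    ≈⟨ ⊗-assoc c a (inv a) ⟩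
  c ⊗ (a ⊗ inv a)    ≈⟨ ⊗-congʳ c (inv-inverseʳ u) ⟩
  c ⊗ one            ≈⟨ FPS.*-identityʳ c ⟩
  c                  ∎
  where open ≋-Reasoning

inv-unique : ∀ {a} b → ConstOne a → b ⊗ a ≋ one → b ≋ inv a
inv-unique {a} b u e = ⊗-cancelʳ b (inv a) u (FPS.trans e (FPS.sym (inv-inverseˡ u)))

inv-cong : ∀ {a b} → ConstOne a → a ≋ b → inv a ≋ inv b
inv-cong {a} u e = inv-unique (inv a) (ConstOne-≋ e u) (FPS.trans (⊗-congʳ (inv a) (FPS.sym e)) (inv-inverseˡ u))

inv-⊗ : ∀ {a b} → ConstOne a → ConstOne b → inv (a ⊗ b) ≋ inv a ⊗ inv b
inv-⊗ {a} {b} u v = FPS.sym (inv-unique (inv a ⊗ inv b) (ConstOne-⊗ u v) (begin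
  (inv a ⊗ inv b) ⊗ (a ⊗ b)    ≈⟨ ⊗-Props.interchange (inv a) (inv b) a b ⟩
  (inv a ⊗ a) ⊗ (inv b ⊗ b)    ≈⟨ ⊗-cong (inv-inverseˡ u) (inv-inverseˡ v) ⟩
  one ⊗ one                    ≈⟨ ⊗-identityˡ one ⟩
  one                          ∎))
  where open ≋-Reasoning

cong-≋ : ∀ (f : ℕ → FPS) {a b} → a ≡ b → f a ≋ f b
cong-≋ f p n = cong (λ z → f z n) p

qint-Σs : ∀ d m → qint d m ≋ Σs (λ i → mono (d *ℕ i)) m
qint-Σs d = sumL-map-applyUpTo (λ i → mono (d *ℕ i)) id

qint-+ : ∀ d a b → qint d (a +ℕ b) ≋ qint d a ⊕ mono (d *ℕ a) ⊗ qint d b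
qint-+ d a b = begin
  qint d (a +ℕ b)                                                      ≈⟨ qint-Σs d (a +ℕ b) ⟩
  Σs (λ i → mono (d *ℕ i)) (a +ℕ b)                                    ≈⟨ ΣS.big-split (λ i → mono (d *ℕ i)) a b ⟩
  Σs (λ i → mono (d *ℕ i)) a ⊕ Σs (λ i → mono (d *ℕ (a +ℕ i))) b       ≈⟨ ⊕-cong (FPS.sym (qint-Σs d a)) (ΣS.big-cong b split) ⟩
  qint d a ⊕ Σs (λ i → mono (d *ℕ a) ⊗ mono (d *ℕ i)) b                ≈⟨ ⊕-congʳ (qint d a) (ΣS.big-*ˡ (mono (d *ℕ a)) (λ i → mono (d *ℕ i)) b) ⟩
  qint d a ⊕ mono (d *ℕ a) ⊗ Σs (λ i → mono (d *ℕ i)) b                ≈⟨ ⊕-congʳ (qint d a) (⊗-congʳ (mono (d *ℕ a)) (FPS.sym (qint-Σs d b))) ⟩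
  qint d a ⊕ mono (d *ℕ a) ⊗ qint d b                                  ∎
  where
  open ≋-Reasoning
  split : ∀ i → mono (d *ℕ (a +ℕ i)) ≋ mono (d *ℕ a) ⊗ mono (d *ℕ i)
  split i = FPS.trans (mono-cong (ℕP.*-distribˡ-+ d a i)) (FPS.sym (mono-+ (d *ℕ a) (d *ℕ i)))

qint-1 : ∀ d → qint d 1 ≋ one
qint-1 d n = trans (cong (λ e → mono e n + 0ℤ) (ℕP.*-zeroʳ d)) (ℤP.+-identityʳ (one n))

qint-suc : ∀ d m → qint d (suc m) ≋ qint d m ⊕ mono (d *ℕ m)
qint-suc d m = begin
  qint d (suc m)                         ≈⟨ cong-≋ (qint d) (ℕP.+-comm 1 m) ⟩
  qint d (m +ℕ 1)                        ≈⟨ qint-+ d m 1 ⟩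
  qint d m ⊕ mono (d *ℕ m) ⊗ qint d 1    ≈⟨ ⊕-congʳ (qint d m) (FPS.trans (⊗-congʳ (mono (d *ℕ m)) (qint-1 d)) (FPS.*-identityʳ _)) ⟩
  qint d m ⊕ mono (d *ℕ m)               ∎
  where open ≋-Reasoning

ConstOne-qint : ∀ d m → ConstOne (qint (suc d) (suc m))
ConstOne-qint d m = constOne (begin
  qint (suc d) (1 +ℕ m) 0                                    ≡⟨ qint-+ (suc d) 1 m 0 ⟩
  qint (suc d) 1 0 + (mono (suc d *ℕ 1) ⊗ qint (suc d) m) 0  ≡⟨ cong₂ _+_ (qint-1 (suc d) 0) (mono-⊗-below (suc d *ℕ 1) (qint (suc d) m) 0 (s≤s z≤n)) ⟩
  1ℤ                                                         ∎)
  where open ≡.≡-Reasoning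

qint-geometric : ∀ d m → (one ⊖ mono d) ⊗ qint d m ≋ one ⊖ mono (d *ℕ m)
qint-geometric d zero n = begin
  ((one ⊖ mono d) ⊗ zeroS) n   ≡⟨ FPS.zeroʳ (one ⊖ mono d) n ⟩
  0ℤ                           ≡⟨ sym (ℤP.+-inverseʳ (one n)) ⟩
  one n - one n                ≡⟨ cong (λ e → one n - mono e n) (sym (ℕP.*-zeroʳ d)) ⟩
  one n - mono (d *ℕ 0) n      ∎
  where open ≡.≡-Reasoning
qint-geometric d (suc m) = begin
  (one ⊖ mono d) ⊗ qint d (suc m)                                     ≈⟨ ⊗-congʳ (one ⊖ mono d) (qint-suc d m) ⟩
  (one ⊖ mono d) ⊗ (qint d m ⊕ mono (d *ℕ m))                         ≈⟨ expand (mono d) (qint d m) (mono (d *ℕ m)) ⟩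
  (one ⊖ mono d) ⊗ qint d m ⊕ mono (d *ℕ m) ⊖ mono d ⊗ mono (d *ℕ m)  ≈⟨ ⊖-cong (⊕-congˡ (mono (d *ℕ m)) (qint-geometric d m)) (FPS.trans (mono-+ d (d *ℕ m)) (mono-cong (sym (ℕP.*-suc d m)))) ⟩
  one ⊖ mono (d *ℕ m) ⊕ mono (d *ℕ m) ⊖ mono (d *ℕ suc m)             ≈⟨ cancel (mono (d *ℕ m)) (mono (d *ℕ suc m)) ⟩
  one ⊖ mono (d *ℕ suc m)                                             ∎
  where
  open ≋-Reasoning
  expand : ∀ x s y → (one ⊖ x) ⊗ (s ⊕ y) ≋ (one ⊖ x) ⊗ s ⊕ y ⊖ x ⊗ y
  expand = solve 3 (λ x s y → (con 1ℤ :- x) :* (s :+ y) := (con 1ℤ :- x) :* s :+ y :- x :* y) FPS.refl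
  cancel : ∀ y z → one ⊖ y ⊕ y ⊖ z ≋ one ⊖ z
  cancel = solve 2 (λ y z → con 1ℤ :- y :+ y :- z := con 1ℤ :- z) FPS.refl

qfact-Πs : ∀ d m → qfact d m ≋ Πs (λ i → qint d (suc i)) m
qfact-Πs d = prodL-map-applyUpTo (λ i → qint d (suc i)) id

qfact-suc : ∀ d m → qfact d (suc m) ≋ qfact d m ⊗ qint d (suc m)
qfact-suc d m = begin
  qfact d (suc m)                               ≈⟨ qfact-Πs d (suc m) ⟩
  Πs (λ i → qint d (suc i)) (suc m)             ≈⟨ ΠS.big-snoc (λ i → qint d (suc i)) m ⟩
  Πs (λ i → qint d (suc i)) m ⊗ qint d (suc m)  ≈⟨ ⊗-congˡ (qint d (suc m)) (FPS.sym (qfact-Πs d m)) ⟩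
  qfact d m ⊗ qint d (suc m)                    ∎
  where open ≋-Reasoning

ConstOne-qfact : ∀ d m → ConstOne (qfact (suc d) m)
ConstOne-qfact d m = ConstOne-≋ (FPS.sym (qfact-Πs (suc d) m)) (ConstOne-Πs m (ConstOne-qint d))

qbin : ℕ → ℕ → ℕ → FPS
qbin d n zero = one
qbin d zero (suc k) = zeroS
qbin d (suc n) (suc k) = qbin d n k ⊕ mono (d *ℕ suc k) ⊗ qbin d n (suc k)

qbin-> : ∀ d n k → n < k → qbin d n k ≋ zeroS
qbin-> d zero (suc k) _ = FPS.refl
qbin-> d (suc n) (suc k) (s≤s n<k) n′ = begin
  qbin d n k n′ + (mono (d *ℕ suc k) ⊗ qbin d n (suc k)) n′  ≡⟨ cong₂ _+_ (qbin-> d n k n<k n′) (⊗-congʳ (mono (d *ℕ suc k)) (qbin-> d n (suc k) (ℕP.m≤n⇒m≤1+n n<k)) n′) ⟩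
  0ℤ + (mono (d *ℕ suc k) ⊗ zeroS) n′                      ≡⟨ ℤP.+-identityˡ _ ⟩
  (mono (d *ℕ suc k) ⊗ zeroS) n′                           ≡⟨ FPS.zeroʳ (mono (d *ℕ suc k)) n′ ⟩
  0ℤ                                                       ∎
  where open ≡.≡-Reasoning

qbin-diag : ∀ d n → qbin d n n ≋ one
qbin-diag d zero = FPS.refl
qbin-diag d (suc n) = begin
  qbin d n n ⊕ mono (d *ℕ suc n) ⊗ qbin d n (suc n)  ≈⟨ ⊕-cong (qbin-diag d n) (⊗-congʳ (mono (d *ℕ suc n)) (qbin-> d n (suc n) (ℕP.n<1+n n))) ⟩
  one ⊕ mono (d *ℕ suc n) ⊗ zeroS                    ≈⟨ ⊕-congʳ one (FPS.zeroʳ (mono (d *ℕ suc n))) ⟩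
  one ⊕ zeroS                                        ≈⟨ FPS.+-identityʳ one ⟩
  one                                                ∎
  where open ≋-Reasoning

qfact-qbin : ∀ d k m → (qfact d k ⊗ qfact d m) ⊗ qbin d (k +ℕ m) k ≋ qfact d (k +ℕ m)
qfact-qbin d zero m = FPS.trans (FPS.*-identityʳ _) (FPS.*-identityˡ (qfact d m))
qfact-qbin d (suc k) zero = begin
  (qfact d (suc k) ⊗ one) ⊗ qbin d (suc k +ℕ 0) (suc k)  ≈⟨ ⊗-congʳ (qfact d (suc k) ⊗ one) (FPS.trans (cong-≋ (λ n → qbin d n (suc k)) (ℕP.+-identityʳ (suc k))) (qbin-diag d (suc k))) ⟩
  (qfact d (suc k) ⊗ one) ⊗ one                          ≈⟨ FPS.trans (FPS.*-identityʳ _) (FPS.*-identityʳ _) ⟩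
  qfact d (suc k)                                        ≈⟨ cong-≋ (qfact d) (sym (ℕP.+-identityʳ (suc k))) ⟩
  qfact d (suc k +ℕ 0)                                   ∎
  where open ≋-Reasoning
qfact-qbin d (suc k) (suc m) = begin
  (Fk′ ⊗ Fm′) ⊗ (qbin d (k +ℕ suc m) k ⊕ X ⊗ qbin d (k +ℕ suc m) (suc k))
    ≈⟨ FPS.distribˡ (Fk′ ⊗ Fm′) (qbin d (k +ℕ suc m) k) (X ⊗ qbin d (k +ℕ suc m) (suc k)) ⟩
  (Fk′ ⊗ Fm′) ⊗ qbin d (k +ℕ suc m) k ⊕ (Fk′ ⊗ Fm′) ⊗ (X ⊗ qbin d (k +ℕ suc m) (suc k))
    ≈⟨ ⊕-cong first second ⟩
  qint d (suc k) ⊗ G ⊕ (X ⊗ qint d (suc m)) ⊗ G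
    ≈⟨ FPS.sym (FPS.distribʳ G (qint d (suc k)) (X ⊗ qint d (suc m))) ⟩
  (qint d (suc k) ⊕ X ⊗ qint d (suc m)) ⊗ G
    ≈⟨ ⊗-congˡ G (FPS.sym (qint-+ d (suc k) (suc m))) ⟩
  qint d (suc (k +ℕ suc m)) ⊗ G
    ≈⟨ ⊗-comm _ G ⟩
  G ⊗ qint d (suc (k +ℕ suc m))
    ≈⟨ FPS.sym (qfact-suc d (k +ℕ suc m)) ⟩
  qfact d (suc (k +ℕ suc m))
    ∎
  where
  open ≋-Reasoning
  Fk′ Fm′ X G : FPS
  Fk′ = qfact d (suc k)
  Fm′ = qfact d (suc m)
  X = mono (d *ℕ suc k)
  G = qfact d (k +ℕ suc m)
  first : (Fk′ ⊗ Fm′) ⊗ qbin d (k +ℕ suc m) k ≋ qint d (suc k) ⊗ G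
  first = begin
    (Fk′ ⊗ Fm′) ⊗ qbin d (k +ℕ suc m) k                       ≈⟨ ⊗-congˡ _ (⊗-congˡ Fm′ (qfact-suc d k)) ⟩
    ((qfact d k ⊗ qint d (suc k)) ⊗ Fm′) ⊗ qbin d (k +ℕ suc m) k  ≈⟨ shuffle (qfact d k) (qint d (suc k)) Fm′ _ ⟩
    qint d (suc k) ⊗ ((qfact d k ⊗ Fm′) ⊗ qbin d (k +ℕ suc m) k)  ≈⟨ ⊗-congʳ (qint d (suc k)) (qfact-qbin d k (suc m)) ⟩
    qint d (suc k) ⊗ G                                            ∎
    where
    shuffle : ∀ a b c d → ((a ⊗ b) ⊗ c) ⊗ d ≋ b ⊗ ((a ⊗ c) ⊗ d)
    shuffle = solve 4 (λ a b c d → ((a :* b) :* c) :* d := b :* ((a :* c) :* d)) FPS.refl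
  second : (Fk′ ⊗ Fm′) ⊗ (X ⊗ qbin d (k +ℕ suc m) (suc k)) ≋ (X ⊗ qint d (suc m)) ⊗ G
  second = begin
    (Fk′ ⊗ Fm′) ⊗ (X ⊗ qbin d (k +ℕ suc m) (suc k))
      ≈⟨ ⊗-cong (⊗-congʳ Fk′ (qfact-suc d m)) (⊗-congʳ X (cong-≋ (λ n → qbin d n (suc k)) (ℕP.+-suc k m))) ⟩
    (Fk′ ⊗ (qfact d m ⊗ qint d (suc m))) ⊗ (X ⊗ qbin d (suc k +ℕ m) (suc k))
      ≈⟨ shuffle Fk′ (qfact d m) (qint d (suc m)) X _ ⟩
    (X ⊗ qint d (suc m)) ⊗ ((Fk′ ⊗ qfact d m) ⊗ qbin d (suc k +ℕ m) (suc k))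
      ≈⟨ ⊗-congʳ (X ⊗ qint d (suc m)) (FPS.trans (qfact-qbin d (suc k) m) (cong-≋ (qfact d) (sym (ℕP.+-suc k m)))) ⟩
    (X ⊗ qint d (suc m)) ⊗ G
      ∎
    where
    shuffle : ∀ a b c x e → (a ⊗ (b ⊗ c)) ⊗ (x ⊗ e) ≋ (x ⊗ c) ⊗ ((a ⊗ b) ⊗ e)
    shuffle = solve 5 (λ a b c x e → (a :* (b :* c)) :* (x :* e) := (x :* c) :* ((a :* b) :* e)) FPS.refl

qbin-sym : ∀ d k m → qbin (suc d) (k +ℕ m) k ≋ qbin (suc d) (m +ℕ k) m
qbin-sym d k m = ⊗-cancelʳ (qbin D (k +ℕ m) k) (qbin D (m +ℕ k) m) (ConstOne-⊗ (ConstOne-qfact d k) (ConstOne-qfact d m)) (begin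
  qbin D (k +ℕ m) k ⊗ (qfact D k ⊗ qfact D m)  ≈⟨ ⊗-comm (qbin D (k +ℕ m) k) (qfact D k ⊗ qfact D m) ⟩
  (qfact D k ⊗ qfact D m) ⊗ qbin D (k +ℕ m) k  ≈⟨ qfact-qbin D k m ⟩
  qfact D (k +ℕ m)                             ≈⟨ cong-≋ (qfact D) (ℕP.+-comm k m) ⟩
  qfact D (m +ℕ k)                             ≈⟨ FPS.sym (qfact-qbin D m k) ⟩
  (qfact D m ⊗ qfact D k) ⊗ qbin D (m +ℕ k) m  ≈⟨ ⊗-congˡ (qbin D (m +ℕ k) m) (⊗-comm (qfact D m) (qfact D k)) ⟩
  (qfact D k ⊗ qfact D m) ⊗ qbin D (m +ℕ k) m  ≈⟨ ⊗-comm (qfact D k ⊗ qfact D m) (qbin D (m +ℕ k) m) ⟩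
  qbin D (m +ℕ k) m ⊗ (qfact D k ⊗ qfact D m)  ∎)
  where
  open ≋-Reasoning
  D : ℕ
  D = suc d

-- The second Pascal recurrence, obtained from the first by symmetry.
qbin-pascal₂ : ∀ d k m → qbin (suc d) (suc (k +ℕ m)) (suc k) ≋ mono (suc d *ℕ m) ⊗ qbin (suc d) (k +ℕ m) k ⊕ qbin (suc d) (k +ℕ m) (suc k)
qbin-pascal₂ d k zero = begin
  qbin D (suc (k +ℕ 0)) (suc k)                        ≈⟨ cong-≋ (λ n → qbin D (suc n) (suc k)) (ℕP.+-identityʳ k) ⟩
  qbin D (suc k) (suc k)                               ≈⟨ qbin-diag D (suc k) ⟩
  one                                                  ≈⟨ FPS.sym (FPS.+-identityʳ one) ⟩
  one ⊕ zeroS                                          ≈⟨ FPS.sym (⊕-cong low (qbin-> D (k +ℕ 0) (suc k) (s≤s (ℕP.≤-reflexive (ℕP.+-identityʳ k))))) ⟩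
  mono (D *ℕ 0) ⊗ qbin D (k +ℕ 0) k ⊕ qbin D (k +ℕ 0) (suc k) ∎
  where
  open ≋-Reasoning
  D : ℕ
  D = suc d
  low : mono (D *ℕ 0) ⊗ qbin D (k +ℕ 0) k ≋ one
  low = begin
    mono (D *ℕ 0) ⊗ qbin D (k +ℕ 0) k  ≈⟨ ⊗-cong (mono-cong (ℕP.*-zeroʳ D)) (cong-≋ (λ n → qbin D n k) (ℕP.+-identityʳ k)) ⟩
    one ⊗ qbin D k k                   ≈⟨ ⊗-identityˡ (qbin D k k) ⟩
    qbin D k k                         ≈⟨ qbin-diag D k ⟩
    one                                ∎
qbin-pascal₂ d k (suc m) = begin
  qbin D (suc (k +ℕ suc m)) (suc k)
    ≈⟨ qbin-sym d (suc k) (suc m) ⟩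
  qbin D (m +ℕ suc k) m ⊕ mono (D *ℕ suc m) ⊗ qbin D (m +ℕ suc k) (suc m)
    ≈⟨ ⊕-cong (FPS.sym (qbin-sym d (suc k) m)) (⊗-congʳ (mono (D *ℕ suc m)) (FPS.trans (cong-≋ (λ n → qbin D n (suc m)) (ℕP.+-suc m k)) (FPS.sym (qbin-sym d k (suc m))))) ⟩
  qbin D (suc k +ℕ m) (suc k) ⊕ mono (D *ℕ suc m) ⊗ qbin D (k +ℕ suc m) k
    ≈⟨ FPS.+-comm (qbin D (suc k +ℕ m) (suc k)) (mono (D *ℕ suc m) ⊗ qbin D (k +ℕ suc m) k) ⟩
  mono (D *ℕ suc m) ⊗ qbin D (k +ℕ suc m) k ⊕ qbin D (suc k +ℕ m) (suc k)
    ≈⟨ ⊕-congʳ (mono (D *ℕ suc m) ⊗ qbin D (k +ℕ suc m) k) (cong-≋ (λ n → qbin D n (suc k)) (sym (ℕP.+-suc k m))) ⟩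
  mono (D *ℕ suc m) ⊗ qbin D (k +ℕ suc m) k ⊕ qbin D (k +ℕ suc m) (suc k)
    ∎
  where
  open ≋-Reasoning
  D : ℕ
  D = suc d

elim-≤ : ∀ {k n} → k ≤ n → (P : ℕ → Set) → (∀ m → P (k +ℕ m)) → P n
elim-≤ {k} {n} k≤n P h = subst P (ℕP.m+[n∸m]≡n k≤n) (h (n ∸ k))

qbin-pascal₂′ : ∀ d n k → k ≤ n → qbin (suc d) (suc n) (suc k) ≋ mono (suc d *ℕ (n ∸ k)) ⊗ qbin (suc d) n k ⊕ qbin (suc d) n (suc k)
qbin-pascal₂′ d n k k≤n = elim-≤ k≤n
  (λ n → qbin (suc d) (suc n) (suc k) ≋ mono (suc d *ℕ (n ∸ k)) ⊗ qbin (suc d) n k ⊕ qbin (suc d) n (suc k))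
  (λ m → FPS.trans (qbin-pascal₂ d k m) (⊕-congˡ (qbin (suc d) (k +ℕ m) (suc k)) (⊗-congˡ (qbin (suc d) (k +ℕ m) k) (mono-cong (cong (suc d *ℕ_) (sym (ℕP.m+n∸m≡n k m)))))))

Σs-qbin-pascal₂ : ∀ d (c : ℕ → ℕ) n →
  Σs (λ k → mono (c k) ⊗ qbin (suc d) (suc n) (suc k)) (suc n)
    ≋ Σs (λ k → mono (c k) ⊗ (mono (suc d *ℕ (n ∸ k)) ⊗ qbin (suc d) n k)) (suc n) ⊕ Σs (λ k → mono (c k) ⊗ qbin (suc d) n (suc k)) (suc n)
Σs-qbin-pascal₂ d c n = FPS.trans
  (ΣS.big-cong< (suc n) (λ k k<1+n → FPS.trans (⊗-congʳ (mono (c k)) (qbin-pascal₂′ d n k (ℕP.≤-pred k<1+n)))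
    (FPS.distribˡ (mono (c k)) (mono (suc d *ℕ (n ∸ k)) ⊗ qbin (suc d) n k) (qbin (suc d) n (suc k)))))
  (ΣS.big-∙ (λ k → mono (c k) ⊗ (mono (suc d *ℕ (n ∸ k)) ⊗ qbin (suc d) n k)) (λ k → mono (c k) ⊗ qbin (suc d) n (suc k)) (suc n))

Σs-drop-last : ∀ f m → f m ≋ zeroS → Σs f (suc m) ≋ Σs f m
Σs-drop-last f m e = FPS.trans (ΣS.big-snoc f m) (FPS.trans (⊕-congʳ (Σs f m) e) (FPS.+-identityʳ (Σs f m)))

poch-suc : ∀ a d k → poch a d (suc k) ≋ poch a d k ⊗ (one ⊖ a ⊗ mono (d *ℕ k))
poch-suc a d k = begin
  poch a d (suc k)                              ≈⟨ prodL-map-applyUpTo f id (suc k) ⟩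
  Πs f (suc k)                                  ≈⟨ ΠS.big-snoc f k ⟩
  Πs f k ⊗ f k                                  ≈⟨ ⊗-congˡ (f k) (FPS.sym (prodL-map-applyUpTo f id k)) ⟩
  poch a d k ⊗ (one ⊖ a ⊗ mono (d *ℕ k))        ∎
  where
  open ≋-Reasoning
  f : ℕ → FPS
  f = λ j → one ⊖ a ⊗ mono (d *ℕ j)

lhsPartial-suc : ∀ k → lhsPartial (suc k) ≋ lhsPartial k ⊗ (one ⊕ mono (suc k))
lhsPartial-suc k = FPS.trans (poch-suc (negate (mono 1)) 1 k) (⊗-congʳ (lhsPartial k) factor)
  where
  factor : one ⊖ negate (mono 1) ⊗ mono (1 *ℕ k) ≋ one ⊕ mono (suc k)
  factor n = begin
    one n - (negate (mono 1) ⊗ mono (1 *ℕ k)) n  ≡⟨ cong (λ x → one n - x) (sym (-‿distribˡ-* (mono 1) (mono (1 *ℕ k)) n)) ⟩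
    one n - - (mono 1 ⊗ mono (1 *ℕ k)) n         ≡⟨ cong (one n +_) (ℤP.neg-involutive _) ⟩
    one n + (mono 1 ⊗ mono (1 *ℕ k)) n           ≡⟨ cong (one n +_) (FPS.trans (mono-+ 1 (1 *ℕ k)) (mono-cong (cong suc (ℕP.*-identityˡ k))) n) ⟩
    one n + mono (suc k) n                       ∎
    where open ≡.≡-Reasoning

ConstOne-lhsPartial : ∀ k → ConstOne (lhsPartial k)
ConstOne-lhsPartial zero = constOne refl
ConstOne-lhsPartial (suc k) = ConstOne-≋ (FPS.sym (lhsPartial-suc k)) (ConstOne-⊗ (ConstOne-lhsPartial k) (constOne refl))

qbinSum : ℕ → (ℕ → ℕ) → ℕ → FPS
qbinSum d c n = Σs (λ k → mono (c k) ⊗ qbin d n k) (suc n)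

qbinSum-head : ∀ d c n → c 0 ≡ 0 → qbinSum d c n ≋ one ⊕ Σs (λ k → mono (c (suc k)) ⊗ qbin d n (suc k)) n
qbinSum-head d c n c₀≡0 = ⊕-congˡ (Σs (λ k → mono (c (suc k)) ⊗ qbin d n (suc k)) n)
  (FPS.trans (⊗-congˡ one (mono-cong c₀≡0)) (⊗-identityˡ one))

-- Expanding every binomial of index n + 1 by the second Pascal recurrence.
qbinSum-suc : ∀ d c n → c 0 ≡ 0 →
  qbinSum (suc d) c (suc n) ≋ qbinSum (suc d) c n ⊕ Σs (λ k → mono (c (suc k)) ⊗ (mono (suc d *ℕ (n ∸ k)) ⊗ qbin (suc d) n k)) (suc n)
qbinSum-suc d c n c₀≡0 = begin
  qbinSum D c (suc n)     ≈⟨ qbinSum-head D c (suc n) c₀≡0 ⟩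
  one ⊕ Σs (λ k → mono (c (suc k)) ⊗ qbin D (suc n) (suc k)) (suc n)
                          ≈⟨ ⊕-congʳ one (Σs-qbin-pascal₂ d (λ k → c (suc k)) n) ⟩
  one ⊕ (S₁ ⊕ S₂)         ≈⟨ ⊕-Props.x∙yz≈xz∙y one S₁ S₂ ⟩
  (one ⊕ S₂) ⊕ S₁         ≈⟨ ⊕-congˡ S₁ (⊕-congʳ one (Σs-drop-last (λ k → mono (c (suc k)) ⊗ qbin D n (suc k)) n vanish)) ⟩
  (one ⊕ Σs (λ k → mono (c (suc k)) ⊗ qbin D n (suc k)) n) ⊕ S₁
                          ≈⟨ ⊕-congˡ S₁ (FPS.sym (qbinSum-head D c n c₀≡0)) ⟩
  qbinSum D c n ⊕ S₁      ∎
  where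
  open ≋-Reasoning
  D : ℕ
  S₁ S₂ : FPS
  D = suc d
  S₁ = Σs (λ k → mono (c (suc k)) ⊗ (mono (D *ℕ (n ∸ k)) ⊗ qbin D n k)) (suc n)
  S₂ = Σs (λ k → mono (c (suc k)) ⊗ qbin D n (suc k)) (suc n)
  vanish : mono (c (suc n)) ⊗ qbin D n (suc n) ≋ zeroS
  vanish = FPS.trans (⊗-congʳ (mono (c (suc n))) (qbin-> D n (suc n) (ℕP.n<1+n n))) (FPS.zeroʳ (mono (c (suc n))))

lhsPartial-characterisation : ∀ (F : ℕ → FPS) → F 0 ≋ one → (∀ n → F (suc n) ≋ F n ⊕ mono (suc n) ⊗ F n) → ∀ n → F n ≋ lhsPartial n
lhsPartial-characterisation F F₀ Fsuc zero = F₀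
lhsPartial-characterisation F F₀ Fsuc (suc n) = begin
  F (suc n)                                ≈⟨ Fsuc n ⟩
  F n ⊕ mono (suc n) ⊗ F n                 ≈⟨ factor (F n) (mono (suc n)) ⟩
  F n ⊗ (one ⊕ mono (suc n))               ≈⟨ ⊗-congˡ (one ⊕ mono (suc n)) (lhsPartial-characterisation F F₀ Fsuc n) ⟩
  lhsPartial n ⊗ (one ⊕ mono (suc n))      ≈⟨ FPS.sym (lhsPartial-suc n) ⟩
  lhsPartial (suc n)                       ∎
  where
  open ≋-Reasoning
  factor : ∀ f x → f ⊕ x ⊗ f ≋ f ⊗ (one ⊕ x)
  factor = solve 2 (λ f x → f :+ x :* f := f :* (con 1ℤ :+ x)) FPS.refl

qbinSum-zero : ∀ d c → c 0 ≡ 0 → qbinSum d c 0 ≋ one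
qbinSum-zero d c c₀≡0 = FPS.trans (qbinSum-head d c 0 c₀≡0) (FPS.+-identityʳ one)

tri : ℕ → ℕ
tri zero = 0
tri (suc m) = tri m +ℕ suc m

-- Rothe's q-binomial theorem at z = q:  (-q;q)_n = Σ_k q^(k(k+1)/2) [n choose k]_q.
qbinSum-tri≋lhsPartial : ∀ n → qbinSum 1 tri n ≋ lhsPartial n
qbinSum-tri≋lhsPartial = lhsPartial-characterisation (qbinSum 1 tri) (qbinSum-zero 1 tri refl) step
  where
  exponent : ∀ n k → k ≤ n → tri (suc k) +ℕ 1 *ℕ (n ∸ k) ≡ suc n +ℕ tri k
  exponent n k k≤n = elim-≤ k≤n (λ n → tri (suc k) +ℕ 1 *ℕ (n ∸ k) ≡ suc n +ℕ tri k)
    (λ m → trans (cong (λ j → tri (suc k) +ℕ 1 *ℕ j) (ℕP.m+n∸m≡n k m)) (arith (tri k) k m))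
    where
    arith : ∀ t k m → t +ℕ suc k +ℕ 1 *ℕ m ≡ suc (k +ℕ m) +ℕ t
    arith = ℕSolver.solve-∀
  step : ∀ n → qbinSum 1 tri (suc n) ≋ qbinSum 1 tri n ⊕ mono (suc n) ⊗ qbinSum 1 tri n
  step n = FPS.trans (qbinSum-suc 0 tri n refl) (⊕-congʳ (qbinSum 1 tri n) (FPS.trans
    (ΣS.big-cong< (suc n) (λ k k<1+n → FPS.trans (mono-⊗-assoc (tri (suc k)) (1 *ℕ (n ∸ k)) (qbin 1 n k))
      (FPS.trans (⊗-congˡ (qbin 1 n k) (mono-cong (exponent n k (ℕP.≤-pred k<1+n)))) (FPS.sym (mono-⊗-assoc (suc n) (tri k) (qbin 1 n k))))))
    (ΣS.big-*ˡ (mono (suc n)) (λ k → mono (tri k) ⊗ qbin 1 n k) (suc n))))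

gaussSum : ℕ → ℕ → FPS
gaussSum e = qbinSum 2 (e *ℕ_)

-- Gauss:  (-q;q)_n = Σ_k q^k [n choose k]_{q²}.
gaussSum-1≋lhsPartial : ∀ n → gaussSum 1 n ≋ lhsPartial n
gaussSum-1≋lhsPartial = lhsPartial-characterisation (gaussSum 1) (qbinSum-zero 2 (1 *ℕ_) refl) step
  where
  exponent : ∀ n k → k ≤ n → 1 *ℕ suc k +ℕ 2 *ℕ (n ∸ k) ≡ suc n +ℕ (n ∸ k)
  exponent n k k≤n = elim-≤ k≤n (λ n → 1 *ℕ suc k +ℕ 2 *ℕ (n ∸ k) ≡ suc n +ℕ (n ∸ k))
    (λ m → trans (cong (λ j → 1 *ℕ suc k +ℕ 2 *ℕ j) (ℕP.m+n∸m≡n k m))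
             (trans (arith k m) (cong (λ j → suc (k +ℕ m) +ℕ j) (sym (ℕP.m+n∸m≡n k m)))))
    where
    arith : ∀ k m → 1 *ℕ suc k +ℕ 2 *ℕ m ≡ suc (k +ℕ m) +ℕ m
    arith = ℕSolver.solve-∀
  reflect : ∀ n → Σs (λ k → mono (n ∸ k) ⊗ qbin 2 n k) (suc n) ≋ gaussSum 1 n
  reflect n = FPS.trans (ΣS.big-reverse (λ k → mono (n ∸ k) ⊗ qbin 2 n k) (suc n))
    (ΣS.big-cong< (suc n) (λ i i<1+n → mirror i (ℕP.≤-pred i<1+n)))
    where
    mirror : ∀ i → i ≤ n → mono (n ∸ (n ∸ i)) ⊗ qbin 2 n (n ∸ i) ≋ mono (1 *ℕ i) ⊗ qbin 2 n i
    mirror i i≤n = ⊗-cong (mono-cong (trans (ℕP.m∸[m∸n]≡n i≤n) (sym (ℕP.*-identityˡ i)))) (begin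
      qbin 2 n (n ∸ i)                  ≈⟨ cong-≋ (λ j → qbin 2 j (n ∸ i)) (sym (trans (ℕP.+-comm (n ∸ i) i) (ℕP.m+[n∸m]≡n i≤n))) ⟩
      qbin 2 ((n ∸ i) +ℕ i) (n ∸ i)     ≈⟨ FPS.sym (qbin-sym 1 i (n ∸ i)) ⟩
      qbin 2 (i +ℕ (n ∸ i)) i           ≈⟨ cong-≋ (λ j → qbin 2 j i) (ℕP.m+[n∸m]≡n i≤n) ⟩
      qbin 2 n i                        ∎)
      where open ≋-Reasoning
  step : ∀ n → gaussSum 1 (suc n) ≋ gaussSum 1 n ⊕ mono (suc n) ⊗ gaussSum 1 n
  step n = FPS.trans (qbinSum-suc 1 (1 *ℕ_) n refl) (⊕-congʳ (gaussSum 1 n) (FPS.trans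
    (ΣS.big-cong< (suc n) (λ k k<1+n → FPS.trans (mono-⊗-assoc (1 *ℕ suc k) (2 *ℕ (n ∸ k)) (qbin 2 n k))
      (FPS.trans (⊗-congˡ (qbin 2 n k) (mono-cong (exponent n k (ℕP.≤-pred k<1+n)))) (FPS.sym (mono-⊗-assoc (suc n) (n ∸ k) (qbin 2 n k))))))
    (FPS.trans (ΣS.big-*ˡ (mono (suc n)) (λ k → mono (n ∸ k) ⊗ qbin 2 n k) (suc n)) (⊗-congʳ (mono (suc n)) (reflect n)))))

-- Expanding by the first Pascal recurrence instead.
gaussSum-1-suc : ∀ n → gaussSum 1 (suc n) ≋ mono 1 ⊗ gaussSum 1 n ⊕ gaussSum 3 n
gaussSum-1-suc n = begin
  gaussSum 1 (suc n)
    ≈⟨ qbinSum-head 2 (1 *ℕ_) (suc n) refl ⟩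
  one ⊕ Σs (λ k → mono (1 *ℕ suc k) ⊗ (qbin 2 n k ⊕ mono (2 *ℕ suc k) ⊗ qbin 2 n (suc k))) (suc n)
    ≈⟨ ⊕-congʳ one (FPS.trans (ΣS.big-cong (suc n) (λ k → FPS.distribˡ (mono (1 *ℕ suc k)) (qbin 2 n k) (mono (2 *ℕ suc k) ⊗ qbin 2 n (suc k))))
                              (ΣS.big-∙ (λ k → mono (1 *ℕ suc k) ⊗ qbin 2 n k) (λ k → mono (1 *ℕ suc k) ⊗ (mono (2 *ℕ suc k) ⊗ qbin 2 n (suc k))) (suc n))) ⟩
  one ⊕ (Σs (λ k → mono (1 *ℕ suc k) ⊗ qbin 2 n k) (suc n) ⊕ Σs (λ k → mono (1 *ℕ suc k) ⊗ (mono (2 *ℕ suc k) ⊗ qbin 2 n (suc k))) (suc n))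
    ≈⟨ ⊕-congʳ one (⊕-cong shifted merged) ⟩
  one ⊕ (mono 1 ⊗ gaussSum 1 n ⊕ Σs (λ k → mono (3 *ℕ suc k) ⊗ qbin 2 n (suc k)) n)
    ≈⟨ ⊕-Props.x∙yz≈y∙xz one (mono 1 ⊗ gaussSum 1 n) (Σs (λ k → mono (3 *ℕ suc k) ⊗ qbin 2 n (suc k)) n) ⟩
  mono 1 ⊗ gaussSum 1 n ⊕ (one ⊕ Σs (λ k → mono (3 *ℕ suc k) ⊗ qbin 2 n (suc k)) n)
    ≈⟨ ⊕-congʳ (mono 1 ⊗ gaussSum 1 n) (FPS.sym (qbinSum-head 2 (3 *ℕ_) n refl)) ⟩
  mono 1 ⊗ gaussSum 1 n ⊕ gaussSum 3 n
    ∎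
  where
  open ≋-Reasoning
  shifted : Σs (λ k → mono (1 *ℕ suc k) ⊗ qbin 2 n k) (suc n) ≋ mono 1 ⊗ gaussSum 1 n
  shifted = FPS.trans (ΣS.big-cong (suc n) (λ k → FPS.sym (mono-⊗-assoc 1 (1 *ℕ k) (qbin 2 n k))))
                      (ΣS.big-*ˡ (mono 1) (λ k → mono (1 *ℕ k) ⊗ qbin 2 n k) (suc n))
  merged : Σs (λ k → mono (1 *ℕ suc k) ⊗ (mono (2 *ℕ suc k) ⊗ qbin 2 n (suc k))) (suc n) ≋ Σs (λ k → mono (3 *ℕ suc k) ⊗ qbin 2 n (suc k)) n
  merged = FPS.trans (ΣS.big-cong (suc n) (λ k → FPS.trans (mono-⊗-assoc (1 *ℕ suc k) (2 *ℕ suc k) (qbin 2 n (suc k)))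
                                                   (⊗-congˡ (qbin 2 n (suc k)) (mono-cong (sym (ℕP.*-distribʳ-+ (suc k) 1 2))))))
                     (Σs-drop-last (λ k → mono (3 *ℕ suc k) ⊗ qbin 2 n (suc k)) n
                        (FPS.trans (⊗-congʳ (mono (3 *ℕ suc n)) (qbin-> 2 n (suc n) (ℕP.n<1+n n))) (FPS.zeroʳ (mono (3 *ℕ suc n)))))

qbinPred : ℕ → ℕ → ℕ → FPS
qbinPred d n zero = zeroS
qbinPred d n (suc k) = qbin d n k

-- The q-ballot form of the q-Yamanouchi number:
-- Y(k+r, k) = [2k+r choose k] − q^(d(r+1)) [2k+r choose k−1].
qBallot : ℕ → ℕ → ℕ → FPS
qBallot d k r = qbin d (k +ℕ r +ℕ k) k ⊖ mono (d *ℕ suc r) ⊗ qbinPred d (k +ℕ r +ℕ k) k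

yamDenominator : ℕ → ℕ → ℕ → FPS
yamDenominator d k r = qint d (suc (k +ℕ r)) ⊗ (qfact d (k +ℕ r) ⊗ qfact d k)

ConstOne-yamDenominator : ∀ d k r → ConstOne (yamDenominator (suc d) k r)
ConstOne-yamDenominator d k r = ConstOne-⊗ (ConstOne-qint d (k +ℕ r)) (ConstOne-⊗ (ConstOne-qfact d (k +ℕ r)) (ConstOne-qfact d k))

qYam-cleared : ∀ d k r → qYam (suc d) (k +ℕ r) k ⊗ yamDenominator (suc d) k r ≋ qint (suc d) (suc r) ⊗ qfact (suc d) (k +ℕ r +ℕ k)
qYam-cleared d k r = begin
  qYam D (k +ℕ r) k ⊗ (A ⊗ C)
    ≈⟨ ⊗-congˡ (A ⊗ C) (⊗-cong (⊗-congˡ (inv A) (cong-≋ (λ j → qint D (suc j)) (ℕP.m+n∸m≡n k r)))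
                                (⊗-congʳ (qfact D M) (inv-cong (ConstOne-⊗ (ConstOne-qfact d (k +ℕ r)) (ConstOne-qfact d (M ∸ (k +ℕ r))))
                                                               (⊗-congʳ (qfact D (k +ℕ r)) (cong-≋ (qfact D) (ℕP.m+n∸m≡n (k +ℕ r) k)))))) ⟩
  (qint D (suc r) ⊗ inv A ⊗ (qfact D M ⊗ inv C)) ⊗ (A ⊗ C)
    ≈⟨ shuffle (qint D (suc r)) (inv A) (qfact D M) (inv C) A C ⟩
  (qint D (suc r) ⊗ qfact D M) ⊗ ((inv A ⊗ A) ⊗ (inv C ⊗ C))
    ≈⟨ ⊗-congʳ (qint D (suc r) ⊗ qfact D M) (⊗-cong (inv-inverseˡ (ConstOne-qint d (k +ℕ r))) (inv-inverseˡ (ConstOne-⊗ (ConstOne-qfact d (k +ℕ r)) (ConstOne-qfact d k)))) ⟩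
  (qint D (suc r) ⊗ qfact D M) ⊗ (one ⊗ one)
    ≈⟨ FPS.trans (⊗-congʳ (qint D (suc r) ⊗ qfact D M) (⊗-identityˡ one)) (FPS.*-identityʳ (qint D (suc r) ⊗ qfact D M)) ⟩
  qint D (suc r) ⊗ qfact D M
    ∎
  where
  open ≋-Reasoning
  D M : ℕ
  A C : FPS
  D = suc d
  M = k +ℕ r +ℕ k
  A = qint D (suc (k +ℕ r))
  C = qfact D (k +ℕ r) ⊗ qfact D k
  shuffle : ∀ a b c e x y → (a ⊗ b ⊗ (c ⊗ e)) ⊗ (x ⊗ y) ≋ (a ⊗ c) ⊗ ((b ⊗ x) ⊗ (e ⊗ y))
  shuffle = solve 6 (λ a b c e x y → (a :* b :* (c :* e)) :* (x :* y) := (a :* c) :* ((b :* x) :* (e :* y))) FPS.refl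

qBallot-cleared : ∀ d k r → qBallot (suc d) k r ⊗ yamDenominator (suc d) k r ≋ qint (suc d) (suc r) ⊗ qfact (suc d) (k +ℕ r +ℕ k)
qBallot-cleared d zero r = begin
  (one ⊖ mono (D *ℕ suc r) ⊗ zeroS) ⊗ yamDenominator D 0 r
    ≈⟨ ⊗-congˡ (yamDenominator D 0 r) (FPS.trans (⊖-congʳ one (FPS.zeroʳ (mono (D *ℕ suc r)))) (λ n → ℤP.+-identityʳ (one n))) ⟩
  one ⊗ (qint D (suc r) ⊗ (qfact D r ⊗ one))
    ≈⟨ ⊗-identityˡ (qint D (suc r) ⊗ (qfact D r ⊗ one)) ⟩
  qint D (suc r) ⊗ (qfact D r ⊗ one)
    ≈⟨ ⊗-congʳ (qint D (suc r)) (FPS.trans (FPS.*-identityʳ (qfact D r)) (cong-≋ (qfact D) (sym (ℕP.+-identityʳ r)))) ⟩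
  qint D (suc r) ⊗ qfact D (r +ℕ 0)
    ∎
  where
  open ≋-Reasoning
  D : ℕ
  D = suc d
qBallot-cleared d (suc k) r = begin
  (qbin D M (suc k) ⊖ W ⊗ qbin D M k) ⊗ (A ⊗ (qfact D (suc k +ℕ r) ⊗ qfact D (suc k)))
    ≈⟨ ⊗-congʳ (qbin D M (suc k) ⊖ W ⊗ qbin D M k) (⊗-congʳ A (⊗-congʳ (qfact D (suc k +ℕ r)) (qfact-suc D k))) ⟩
  (qbin D M (suc k) ⊖ W ⊗ qbin D M k) ⊗ (A ⊗ (qfact D (suc k +ℕ r) ⊗ (qfact D k ⊗ I)))
    ≈⟨ shuffle (qbin D M (suc k)) W (qbin D M k) A (qfact D (suc k +ℕ r)) (qfact D k) I ⟩
  A ⊗ (((qfact D k ⊗ I) ⊗ qfact D (suc k +ℕ r)) ⊗ qbin D M (suc k)) ⊖ W ⊗ I ⊗ ((qfact D k ⊗ (qfact D (suc k +ℕ r) ⊗ A)) ⊗ qbin D M k)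
    ≈⟨ ⊖-cong (⊗-congʳ A upper) (⊗-congʳ (W ⊗ I) lower) ⟩
  A ⊗ qfact D M ⊖ W ⊗ I ⊗ qfact D M
    ≈⟨ factor A W I (qfact D M) ⟩
  (A ⊖ W ⊗ I) ⊗ qfact D M
    ≈⟨ ⊗-congˡ (qfact D M) qint-difference ⟩
  qint D (suc r) ⊗ qfact D M
    ∎
  where
  open ≋-Reasoning
  D M : ℕ
  W A I : FPS
  D = suc d
  M = suc k +ℕ r +ℕ suc k
  W = mono (D *ℕ suc r)
  A = qint D (suc (suc k +ℕ r))
  I = qint D (suc k)
  shuffle : ∀ b₁ w b₀ a f g i → (b₁ ⊖ w ⊗ b₀) ⊗ (a ⊗ (f ⊗ (g ⊗ i))) ≋ a ⊗ (((g ⊗ i) ⊗ f) ⊗ b₁) ⊖ w ⊗ i ⊗ ((g ⊗ (f ⊗ a)) ⊗ b₀)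
  shuffle = solve 7 (λ b₁ w b₀ a f g i → (b₁ :- w :* b₀) :* (a :* (f :* (g :* i))) := a :* (((g :* i) :* f) :* b₁) :- w :* i :* ((g :* (f :* a)) :* b₀)) FPS.refl
  factor : ∀ a w i f → a ⊗ f ⊖ w ⊗ i ⊗ f ≋ (a ⊖ w ⊗ i) ⊗ f
  factor = solve 4 (λ a w i f → a :* f :- w :* i :* f := (a :- w :* i) :* f) FPS.refl
  upper : ((qfact D k ⊗ I) ⊗ qfact D (suc k +ℕ r)) ⊗ qbin D M (suc k) ≋ qfact D M
  upper = begin
    ((qfact D k ⊗ I) ⊗ qfact D (suc k +ℕ r)) ⊗ qbin D M (suc k)  ≈⟨ ⊗-cong (⊗-congˡ (qfact D (suc k +ℕ r)) (FPS.sym (qfact-suc D k))) (cong-≋ (λ n → qbin D n (suc k)) e) ⟩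
    (qfact D (suc k) ⊗ qfact D (suc k +ℕ r)) ⊗ qbin D (suc k +ℕ (suc k +ℕ r)) (suc k)  ≈⟨ qfact-qbin D (suc k) (suc k +ℕ r) ⟩
    qfact D (suc k +ℕ (suc k +ℕ r))  ≈⟨ cong-≋ (qfact D) (sym e) ⟩
    qfact D M  ∎
    where
    e : M ≡ suc k +ℕ (suc k +ℕ r)
    e = ℕP.+-comm (suc k +ℕ r) (suc k)
  lower : (qfact D k ⊗ (qfact D (suc k +ℕ r) ⊗ A)) ⊗ qbin D M k ≋ qfact D M
  lower = begin
    (qfact D k ⊗ (qfact D (suc k +ℕ r) ⊗ A)) ⊗ qbin D M k  ≈⟨ ⊗-cong (⊗-congʳ (qfact D k) (FPS.sym (qfact-suc D (suc k +ℕ r)))) (cong-≋ (λ n → qbin D n k) e) ⟩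
    (qfact D k ⊗ qfact D (suc (suc k +ℕ r))) ⊗ qbin D (k +ℕ suc (suc k +ℕ r)) k  ≈⟨ qfact-qbin D k (suc (suc k +ℕ r)) ⟩
    qfact D (k +ℕ suc (suc k +ℕ r))  ≈⟨ cong-≋ (qfact D) (sym e) ⟩
    qfact D M  ∎
    where
    e : M ≡ k +ℕ suc (suc k +ℕ r)
    e = trans (ℕP.+-comm (suc k +ℕ r) (suc k)) (sym (ℕP.+-suc k (suc k +ℕ r)))
  qint-difference : A ⊖ W ⊗ I ≋ qint D (suc r)
  qint-difference = begin
    A ⊖ W ⊗ I                          ≈⟨ ⊖-congˡ (W ⊗ I) (FPS.trans (cong-≋ (qint D) (cong suc (ℕP.+-comm (suc k) r))) (qint-+ D (suc r) (suc k))) ⟩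
    (qint D (suc r) ⊕ W ⊗ I) ⊖ W ⊗ I   ≈⟨ FPS.trans (FPS.+-assoc (qint D (suc r)) (W ⊗ I) (negate (W ⊗ I))) (FPS.trans (⊕-congʳ (qint D (suc r)) (FPS.-‿inverseʳ (W ⊗ I))) (FPS.+-identityʳ (qint D (suc r)))) ⟩
    qint D (suc r)                     ∎

qYam≋qBallot : ∀ d k r → qYam (suc d) (k +ℕ r) k ≋ qBallot (suc d) k r
qYam≋qBallot d k r = ⊗-cancelʳ (qYam (suc d) (k +ℕ r) k) (qBallot (suc d) k r) (ConstOne-yamDenominator d k r)
  (FPS.trans (qYam-cleared d k r) (FPS.sym (qBallot-cleared d k r)))

m≡n+o⇒m∸n≡o : ∀ {m} n o → m ≡ n +ℕ o → m ∸ n ≡ o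
m≡n+o⇒m∸n≡o n o refl = ℕP.m+n∸m≡n n o

-- Multiplied by 1 − q, summand k becomes
-- a k − b k; since b 0 = b (n+1) = 0 the b's may be shifted by one, and then a (N − k) = − b (k+1)
-- folds Σ_{k≤n} (a k − b (k+1)) into Σ_{k≤N} a k, a combination of Gauss sums.
module OddLevel (n : ℕ) where

  N : ℕ
  N = 2 *ℕ n +ℕ 1

  L : ℕ → ℕ
  L k = 2 *ℕ (n ∸ k) +ℕ 2

  ballot : ℕ → FPS
  ballot k = qbin 2 N k ⊖ mono (2 *ℕ L k) ⊗ qbinPred 2 N k

  summand : ℕ → FPS
  summand k = mono (3 *ℕ k) ⊗ ballot k ⊗ qint 1 (L k)

  a : ℕ → FPS
  a k = (mono (3 *ℕ k) ⊖ mono (N +ℕ 1 +ℕ k)) ⊗ qbin 2 N k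

  b : ℕ → FPS
  b zero = zeroS
  b (suc k) = (mono (2 *ℕ N +ℕ 1 ∸ k) ⊖ mono (3 *ℕ N ∸ 3 *ℕ k)) ⊗ qbin 2 N k

  a-exponent : ∀ k → k ≤ n → 3 *ℕ k +ℕ 1 *ℕ L k ≡ N +ℕ 1 +ℕ k
  a-exponent k k≤n = elim-≤ k≤n (λ n → 3 *ℕ k +ℕ 1 *ℕ (2 *ℕ (n ∸ k) +ℕ 2) ≡ 2 *ℕ n +ℕ 1 +ℕ 1 +ℕ k)
    (λ j → trans (cong (λ z → 3 *ℕ k +ℕ 1 *ℕ (2 *ℕ z +ℕ 2)) (ℕP.m+n∸m≡n k j)) (arith k j))
    where
    arith : ∀ k j → 3 *ℕ k +ℕ 1 *ℕ (2 *ℕ j +ℕ 2) ≡ 2 *ℕ (k +ℕ j) +ℕ 1 +ℕ 1 +ℕ k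
    arith = ℕSolver.solve-∀

  b-exponent₁ : ∀ k → suc k ≤ n → 3 *ℕ suc k +ℕ 2 *ℕ L (suc k) ≡ 2 *ℕ N +ℕ 1 ∸ k
  b-exponent₁ k k<n = elim-≤ k<n (λ n → 3 *ℕ suc k +ℕ 2 *ℕ (2 *ℕ (n ∸ suc k) +ℕ 2) ≡ 2 *ℕ (2 *ℕ n +ℕ 1) +ℕ 1 ∸ k)
    (λ j → trans (cong (λ z → 3 *ℕ suc k +ℕ 2 *ℕ (2 *ℕ z +ℕ 2)) (ℕP.m+n∸m≡n (suc k) j)) (sym (m≡n+o⇒m∸n≡o k _ (arith k j))))
    where
    arith : ∀ k j → 2 *ℕ (2 *ℕ (suc k +ℕ j) +ℕ 1) +ℕ 1 ≡ k +ℕ (3 *ℕ suc k +ℕ 2 *ℕ (2 *ℕ j +ℕ 2))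
    arith = ℕSolver.solve-∀

  b-exponent₂ : ∀ k → suc k ≤ n → 3 *ℕ suc k +ℕ 2 *ℕ L (suc k) +ℕ 1 *ℕ L (suc k) ≡ 3 *ℕ N ∸ 3 *ℕ k
  b-exponent₂ k k<n = elim-≤ k<n (λ n → 3 *ℕ suc k +ℕ 2 *ℕ (2 *ℕ (n ∸ suc k) +ℕ 2) +ℕ 1 *ℕ (2 *ℕ (n ∸ suc k) +ℕ 2) ≡ 3 *ℕ (2 *ℕ n +ℕ 1) ∸ 3 *ℕ k)
    (λ j → trans (cong (λ z → 3 *ℕ suc k +ℕ 2 *ℕ (2 *ℕ z +ℕ 2) +ℕ 1 *ℕ (2 *ℕ z +ℕ 2)) (ℕP.m+n∸m≡n (suc k) j)) (sym (m≡n+o⇒m∸n≡o (3 *ℕ k) _ (arith k j))))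
    where
    arith : ∀ k j → 3 *ℕ (2 *ℕ (suc k +ℕ j) +ℕ 1) ≡ 3 *ℕ k +ℕ (3 *ℕ suc k +ℕ 2 *ℕ (2 *ℕ j +ℕ 2) +ℕ 1 *ℕ (2 *ℕ j +ℕ 2))
    arith = ℕSolver.solve-∀

  mirror-exponent : ∀ k → k ≤ n → N +ℕ 1 +ℕ (N ∸ k) ≡ 2 *ℕ N +ℕ 1 ∸ k
  mirror-exponent k k≤n = elim-≤ k≤n (λ n → 2 *ℕ n +ℕ 1 +ℕ 1 +ℕ (2 *ℕ n +ℕ 1 ∸ k) ≡ 2 *ℕ (2 *ℕ n +ℕ 1) +ℕ 1 ∸ k)
    (λ j → trans (cong (λ z → 2 *ℕ (k +ℕ j) +ℕ 1 +ℕ 1 +ℕ z) (m≡n+o⇒m∸n≡o k (k +ℕ 2 *ℕ j +ℕ 1) (arith₁ k j)))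
                 (sym (m≡n+o⇒m∸n≡o k (2 *ℕ (k +ℕ j) +ℕ 1 +ℕ 1 +ℕ (k +ℕ 2 *ℕ j +ℕ 1)) (arith₂ k j))))
    where
    arith₁ : ∀ k j → 2 *ℕ (k +ℕ j) +ℕ 1 ≡ k +ℕ (k +ℕ 2 *ℕ j +ℕ 1)
    arith₁ = ℕSolver.solve-∀
    arith₂ : ∀ k j → 2 *ℕ (2 *ℕ (k +ℕ j) +ℕ 1) +ℕ 1 ≡ k +ℕ (2 *ℕ (k +ℕ j) +ℕ 1 +ℕ 1 +ℕ (k +ℕ 2 *ℕ j +ℕ 1))
    arith₂ = ℕSolver.solve-∀

  last-exponent : 2 *ℕ N +ℕ 1 ∸ n ≡ 3 *ℕ N ∸ 3 *ℕ n
  last-exponent = trans (m≡n+o⇒m∸n≡o n (3 *ℕ n +ℕ 3) (arith₁ n)) (sym (m≡n+o⇒m∸n≡o (3 *ℕ n) (3 *ℕ n +ℕ 3) (arith₂ n)))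
    where
    arith₁ : ∀ n → 2 *ℕ (2 *ℕ n +ℕ 1) +ℕ 1 ≡ n +ℕ (3 *ℕ n +ℕ 3)
    arith₁ = ℕSolver.solve-∀
    arith₂ : ∀ n → 3 *ℕ (2 *ℕ n +ℕ 1) ≡ 3 *ℕ n +ℕ (3 *ℕ n +ℕ 3)
    arith₂ = ℕSolver.solve-∀

  summand-step : ∀ k → k ≤ n → (one ⊖ mono 1) ⊗ summand k ≋ a k ⊖ b k
  summand-step k k≤n = begin
    (one ⊖ mono 1) ⊗ summand k                           ≈⟨ shuffle (one ⊖ mono 1) U (ballot k) (qint 1 (L k)) ⟩
    (U ⊗ ballot k) ⊗ ((one ⊖ mono 1) ⊗ qint 1 (L k))     ≈⟨ ⊗-congʳ (U ⊗ ballot k) (qint-geometric 1 (L k)) ⟩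
    (U ⊗ ballot k) ⊗ (one ⊖ V)                           ≈⟨ expand U (qbin 2 N k) W (qbinPred 2 N k) V ⟩
    (U ⊖ U ⊗ V) ⊗ qbin 2 N k ⊖ (U ⊗ W ⊖ (U ⊗ W) ⊗ V) ⊗ qbinPred 2 N k
                                                         ≈⟨ ⊖-cong (⊗-congˡ (qbin 2 N k) (⊖-congʳ U (FPS.trans (mono-+ (3 *ℕ k) (1 *ℕ L k)) (mono-cong (a-exponent k k≤n))))) (b-part k k≤n) ⟩
    a k ⊖ b k                                            ∎
    where
    open ≋-Reasoning
    U V W : FPS
    U = mono (3 *ℕ k)
    V = mono (1 *ℕ L k)
    W = mono (2 *ℕ L k)
    shuffle : ∀ z u y s → z ⊗ ((u ⊗ y) ⊗ s) ≋ (u ⊗ y) ⊗ (z ⊗ s)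
    shuffle = solve 4 (λ z u y s → z :* ((u :* y) :* s) := (u :* y) :* (z :* s)) FPS.refl
    expand : ∀ u x w y v → (u ⊗ (x ⊖ w ⊗ y)) ⊗ (one ⊖ v) ≋ (u ⊖ u ⊗ v) ⊗ x ⊖ (u ⊗ w ⊖ (u ⊗ w) ⊗ v) ⊗ y
    expand = solve 5 (λ u x w y v → (u :* (x :- w :* y)) :* (con 1ℤ :- v) := (u :- u :* v) :* x :- (u :* w :- (u :* w) :* v) :* y) FPS.refl
    b-part : ∀ k → k ≤ n → (mono (3 *ℕ k) ⊗ mono (2 *ℕ L k) ⊖ (mono (3 *ℕ k) ⊗ mono (2 *ℕ L k)) ⊗ mono (1 *ℕ L k)) ⊗ qbinPred 2 N k ≋ b k
    b-part zero _ = FPS.zeroʳ (mono 0 ⊗ mono (2 *ℕ L 0) ⊖ (mono 0 ⊗ mono (2 *ℕ L 0)) ⊗ mono (1 *ℕ L 0))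
    b-part (suc k) k<n = ⊗-congˡ (qbin 2 N k) (⊖-cong (FPS.trans (mono-+ (3 *ℕ suc k) (2 *ℕ L (suc k))) (mono-cong (b-exponent₁ k k<n)))
      (FPS.trans (⊗-congˡ (mono (1 *ℕ L (suc k))) (mono-+ (3 *ℕ suc k) (2 *ℕ L (suc k))))
                 (FPS.trans (mono-+ (3 *ℕ suc k +ℕ 2 *ℕ L (suc k)) (1 *ℕ L (suc k))) (mono-cong (b-exponent₂ k k<n)))))

  Σa : Σs a (suc N) ≋ gaussSum 3 N ⊖ mono (N +ℕ 1) ⊗ gaussSum 1 N
  Σa = begin
    Σs a (suc N)
      ≈⟨ ΣS.big-cong (suc N) (λ k → distrib (mono (3 *ℕ k)) (mono (N +ℕ 1 +ℕ k)) (qbin 2 N k)) ⟩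
    Σs (λ k → mono (3 *ℕ k) ⊗ qbin 2 N k ⊖ mono (N +ℕ 1 +ℕ k) ⊗ qbin 2 N k) (suc N)
      ≈⟨ ΣS.big-− (λ k → mono (3 *ℕ k) ⊗ qbin 2 N k) (λ k → mono (N +ℕ 1 +ℕ k) ⊗ qbin 2 N k) (suc N) ⟩
    gaussSum 3 N ⊖ Σs (λ k → mono (N +ℕ 1 +ℕ k) ⊗ qbin 2 N k) (suc N)
      ≈⟨ ⊖-congʳ (gaussSum 3 N) (FPS.trans (ΣS.big-cong (suc N) (λ k → FPS.trans (⊗-congˡ (qbin 2 N k) (mono-cong (cong (N +ℕ 1 +ℕ_) (sym (ℕP.*-identityˡ k)))))
                                                                               (FPS.sym (mono-⊗-assoc (N +ℕ 1) (1 *ℕ k) (qbin 2 N k)))))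
                                           (ΣS.big-*ˡ (mono (N +ℕ 1)) (λ k → mono (1 *ℕ k) ⊗ qbin 2 N k) (suc N))) ⟩
    gaussSum 3 N ⊖ mono (N +ℕ 1) ⊗ gaussSum 1 N
      ∎
    where
    open ≋-Reasoning
    distrib : ∀ x y z → (x ⊖ y) ⊗ z ≋ x ⊗ z ⊖ y ⊗ z
    distrib = solve 3 (λ x y z → (x :- y) :* z := x :* z :- y :* z) FPS.refl

  a-mirror : ∀ k → k ≤ n → a (N ∸ k) ≋ negate (b (suc k))
  a-mirror k k≤n = begin
    a (N ∸ k)                                                              ≈⟨ ⊗-cong (⊖-cong (mono-cong (ℕP.*-distribˡ-∸ 3 N k)) (mono-cong (mirror-exponent k k≤n))) qbin-mirror ⟩
    (mono (3 *ℕ N ∸ 3 *ℕ k) ⊖ mono (2 *ℕ N +ℕ 1 ∸ k)) ⊗ qbin 2 N k         ≈⟨ flip (mono (3 *ℕ N ∸ 3 *ℕ k)) (mono (2 *ℕ N +ℕ 1 ∸ k)) (qbin 2 N k) ⟩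
    negate (b (suc k))                                                     ∎
    where
    open ≋-Reasoning
    flip : ∀ x y z → (x ⊖ y) ⊗ z ≋ negate ((y ⊖ x) ⊗ z)
    flip = solve 3 (λ x y z → (x :- y) :* z := :- ((y :- x) :* z)) FPS.refl
    k≤N : k ≤ N
    k≤N = ℕP.≤-trans k≤n (ℕP.≤-trans (ℕP.m≤n*m n 2) (ℕP.m≤m+n (2 *ℕ n) 1))
    qbin-mirror : qbin 2 N (N ∸ k) ≋ qbin 2 N k
    qbin-mirror = begin
      qbin 2 N (N ∸ k)                  ≈⟨ cong-≋ (λ j → qbin 2 j (N ∸ k)) (sym (ℕP.m∸n+n≡m k≤N)) ⟩
      qbin 2 ((N ∸ k) +ℕ k) (N ∸ k)     ≈⟨ FPS.sym (qbin-sym 1 k (N ∸ k)) ⟩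
      qbin 2 (k +ℕ (N ∸ k)) k           ≈⟨ cong-≋ (λ j → qbin 2 j k) (ℕP.m+[n∸m]≡n k≤N) ⟩
      qbin 2 N k                        ∎

  Σa-folded : Σs a (suc N) ≋ Σs (λ k → a k ⊖ b (suc k)) (suc n)
  Σa-folded = begin
    Σs a (suc N)                                                   ≈⟨ cong-≋ (Σs a) (arith n) ⟩
    Σs a (suc n +ℕ suc n)                                          ≈⟨ ΣS.big-fold a (suc n) ⟩
    Σs (λ k → a k ⊕ a (n +ℕ suc n ∸ k)) (suc n)                    ≈⟨ ΣS.big-cong< (suc n) (λ k k<1+n → ⊕-congʳ (a k) (FPS.trans (cong-≋ a (cong (_∸ k) (arith′ n))) (a-mirror k (ℕP.≤-pred k<1+n)))) ⟩
    Σs (λ k → a k ⊖ b (suc k)) (suc n)                             ∎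
    where
    open ≋-Reasoning
    arith : ∀ n → suc (2 *ℕ n +ℕ 1) ≡ suc n +ℕ suc n
    arith = ℕSolver.solve-∀
    arith′ : ∀ n → n +ℕ suc n ≡ 2 *ℕ n +ℕ 1
    arith′ = ℕSolver.solve-∀

  b-last : b (suc n) ≋ zeroS
  b-last = begin
    (mono (2 *ℕ N +ℕ 1 ∸ n) ⊖ mono (3 *ℕ N ∸ 3 *ℕ n)) ⊗ qbin 2 N n      ≈⟨ ⊗-congˡ (qbin 2 N n) (⊖-congˡ (mono (3 *ℕ N ∸ 3 *ℕ n)) (mono-cong last-exponent)) ⟩
    (mono (3 *ℕ N ∸ 3 *ℕ n) ⊖ mono (3 *ℕ N ∸ 3 *ℕ n)) ⊗ qbin 2 N n      ≈⟨ ⊗-congˡ (qbin 2 N n) (FPS.-‿inverseʳ (mono (3 *ℕ N ∸ 3 *ℕ n))) ⟩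
    zeroS ⊗ qbin 2 N n                                                  ≈⟨ FPS.zeroˡ (qbin 2 N n) ⟩
    zeroS                                                               ∎
    where open ≋-Reasoning

  Σb-shift : Σs b (suc n) ≋ Σs (λ k → b (suc k)) (suc n)
  Σb-shift = FPS.trans (FPS.+-identityˡ (Σs (λ k → b (suc k)) n)) (FPS.sym (Σs-drop-last (λ k → b (suc k)) n b-last))

  Σsummand≋lhsPartial : Σs summand (suc n) ≋ lhsPartial N
  Σsummand≋lhsPartial = ⊗-cancelʳ (Σs summand (suc n)) (lhsPartial N) (constOne refl)
    (FPS.trans (⊗-comm (Σs summand (suc n)) (one ⊖ mono 1)) (FPS.trans chain (⊗-comm (one ⊖ mono 1) (lhsPartial N))))
    where
    open ≋-Reasoning
    G₁ : FPS
    G₁ = gaussSum 1 N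
    regroup : ∀ r x y → (r ⊗ (one ⊕ y) ⊖ x ⊗ r) ⊖ y ⊗ r ≋ (one ⊖ x) ⊗ r
    regroup = solve 3 (λ r x y → (r :* (con 1ℤ :+ y) :- x :* r) :- y :* r := (con 1ℤ :- x) :* r) FPS.refl
    chain : (one ⊖ mono 1) ⊗ Σs summand (suc n) ≋ (one ⊖ mono 1) ⊗ lhsPartial N
    chain = begin
      (one ⊖ mono 1) ⊗ Σs summand (suc n)               ≈⟨ FPS.sym (ΣS.big-*ˡ (one ⊖ mono 1) summand (suc n)) ⟩
      Σs (λ k → (one ⊖ mono 1) ⊗ summand k) (suc n)     ≈⟨ ΣS.big-cong< (suc n) (λ k k<1+n → summand-step k (ℕP.≤-pred k<1+n)) ⟩
      Σs (λ k → a k ⊖ b k) (suc n)                      ≈⟨ ΣS.big-− a b (suc n) ⟩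
      Σs a (suc n) ⊖ Σs b (suc n)                       ≈⟨ ⊖-congʳ (Σs a (suc n)) Σb-shift ⟩
      Σs a (suc n) ⊖ Σs (λ k → b (suc k)) (suc n)       ≈⟨ FPS.sym (ΣS.big-− a (λ k → b (suc k)) (suc n)) ⟩
      Σs (λ k → a k ⊖ b (suc k)) (suc n)                ≈⟨ FPS.sym Σa-folded ⟩
      Σs a (suc N)                                      ≈⟨ Σa ⟩
      gaussSum 3 N ⊖ mono (N +ℕ 1) ⊗ G₁                 ≈⟨ ⊖-congˡ (mono (N +ℕ 1) ⊗ G₁) gauss-3 ⟩
      (gaussSum 1 (suc N) ⊖ mono 1 ⊗ G₁) ⊖ mono (N +ℕ 1) ⊗ G₁
          ≈⟨ ⊖-cong (⊖-cong (FPS.trans (gaussSum-1≋lhsPartial (suc N)) (lhsPartial-suc N)) (⊗-congʳ (mono 1) (gaussSum-1≋lhsPartial N)))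
                    (⊗-cong (mono-cong (ℕP.+-comm N 1)) (gaussSum-1≋lhsPartial N)) ⟩
      (lhsPartial N ⊗ (one ⊕ mono (suc N)) ⊖ mono 1 ⊗ lhsPartial N) ⊖ mono (suc N) ⊗ lhsPartial N
          ≈⟨ regroup (lhsPartial N) (mono 1) (mono (suc N)) ⟩
      (one ⊖ mono 1) ⊗ lhsPartial N                     ∎
      where
      gauss-3 : gaussSum 3 N ≋ gaussSum 1 (suc N) ⊖ mono 1 ⊗ G₁
      gauss-3 = FPS.sym (FPS.trans (⊖-congˡ (mono 1 ⊗ G₁) (gaussSum-1-suc N)) (cancel (mono 1 ⊗ G₁) (gaussSum 3 N)))
        where
        cancel : ∀ x y → x ⊕ y ⊖ x ≋ y
        cancel = solve 2 (λ x y → x :+ y :- x := y) FPS.refl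

qqPoch : ℕ → FPS
qqPoch m = poch (mono 1) 1 m

ConstOne-qqPoch : ∀ m → ConstOne (qqPoch m)
ConstOne-qqPoch m = ConstOne-≋ (FPS.sym (prodL-map-applyUpTo (λ j → one ⊖ mono 1 ⊗ mono (1 *ℕ j)) id m))
  (ConstOne-Πs m (λ j → constOne (cong (λ x → 1ℤ - x) (mono-⊗-below 1 (mono (1 *ℕ j)) 0 (s≤s z≤n)))))

q²q²Poch : ℕ → FPS
q²q²Poch m = poch (mono 2) 2 m

q²q²Poch≋qqPoch⊗lhsPartial : ∀ m → q²q²Poch m ≋ qqPoch m ⊗ lhsPartial m
q²q²Poch≋qqPoch⊗lhsPartial zero = FPS.sym (⊗-identityˡ one)
q²q²Poch≋qqPoch⊗lhsPartial (suc m) = begin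
  q²q²Poch (suc m)                                       ≈⟨ poch-suc (mono 2) 2 m ⟩
  q²q²Poch m ⊗ (one ⊖ mono 2 ⊗ mono (2 *ℕ m))            ≈⟨ ⊗-cong (q²q²Poch≋qqPoch⊗lhsPartial m) difference-of-squares ⟩
  (qqPoch m ⊗ lhsPartial m) ⊗ (f ⊗ g)                    ≈⟨ ⊗-Props.interchange (qqPoch m) (lhsPartial m) f g ⟩
  (qqPoch m ⊗ f) ⊗ (lhsPartial m ⊗ g)                    ≈⟨ ⊗-cong (FPS.sym (poch-suc (mono 1) 1 m)) (FPS.sym (poch-suc (negate (mono 1)) 1 m)) ⟩
  qqPoch (suc m) ⊗ lhsPartial (suc m)                    ∎
  where
  open ≋-Reasoning
  f g x : FPS
  f = one ⊖ mono 1 ⊗ mono (1 *ℕ m)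
  g = one ⊖ negate (mono 1) ⊗ mono (1 *ℕ m)
  x = mono 1 ⊗ mono (1 *ℕ m)
  squares : ∀ x → one ⊖ x ⊗ x ≋ (one ⊖ x) ⊗ (one ⊖ negate x)
  squares = solve 1 (λ x → con 1ℤ :- x :* x := (con 1ℤ :- x) :* (con 1ℤ :- (:- x))) FPS.refl
  difference-of-squares : one ⊖ mono 2 ⊗ mono (2 *ℕ m) ≋ f ⊗ g
  difference-of-squares = begin
    one ⊖ mono 2 ⊗ mono (2 *ℕ m)           ≈⟨ ⊖-congʳ one (FPS.trans (mono-+ 2 (2 *ℕ m)) (FPS.trans (mono-cong (arith m)) (FPS.trans (FPS.sym (mono-+ (1 +ℕ 1 *ℕ m) (1 +ℕ 1 *ℕ m))) (FPS.sym (⊗-cong (mono-+ 1 (1 *ℕ m)) (mono-+ 1 (1 *ℕ m))))))) ⟩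
    one ⊖ x ⊗ x                            ≈⟨ squares x ⟩
    (one ⊖ x) ⊗ (one ⊖ negate x)           ≈⟨ ⊗-congʳ f (⊖-congʳ one (-‿distribˡ-* (mono 1) (mono (1 *ℕ m)))) ⟩
    f ⊗ g                                  ∎
    where
    arith : ∀ m → 2 +ℕ 2 *ℕ m ≡ (1 +ℕ 1 *ℕ m) +ℕ (1 +ℕ 1 *ℕ m)
    arith = ℕSolver.solve-∀

ConstOne-q²q²Poch : ∀ m → ConstOne (q²q²Poch m)
ConstOne-q²q²Poch m = ConstOne-≋ (FPS.sym (q²q²Poch≋qqPoch⊗lhsPartial m)) (ConstOne-⊗ (ConstOne-qqPoch m) (ConstOne-lhsPartial m))

pairedEulerTerm : ℕ → FPS
pairedEulerTerm n = mono ((2 *ℕ n +ℕ 1) *ℕ n) ⊗ inv (qqPoch (2 *ℕ n +ℕ 1))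

module _ (n : ℕ) where
  open OddLevel n

  qYam≋ballot : ∀ k → k ≤ n → qYam 2 (N ∸ k) k ≋ ballot k
  qYam≋ballot k k≤n = begin
    qYam 2 (N ∸ k) k    ≈⟨ cong-≋ (λ m → qYam 2 m k) (trans (cong (_∸ k) N≡) (ℕP.m+n∸n≡m (k +ℕ r) k)) ⟩
    qYam 2 (k +ℕ r) k   ≈⟨ qYam≋qBallot 1 k r ⟩
    qBallot 2 k r       ≈⟨ ⊖-cong (cong-≋ (λ j → qbin 2 j k) (sym N≡)) (⊗-cong (mono-cong (cong (2 *ℕ_) (sym (ℕP.+-suc (2 *ℕ (n ∸ k)) 1)))) (cong-≋ (λ j → qbinPred 2 j k) (sym N≡))) ⟩
    ballot k            ∎
    where
    open ≋-Reasoning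
    r : ℕ
    r = 2 *ℕ (n ∸ k) +ℕ 1
    N≡ : N ≡ k +ℕ r +ℕ k
    N≡ = elim-≤ k≤n (λ n → 2 *ℕ n +ℕ 1 ≡ k +ℕ (2 *ℕ (n ∸ k) +ℕ 1) +ℕ k)
      (λ j → trans (arith k j) (cong (λ z → k +ℕ (2 *ℕ z +ℕ 1) +ℕ k) (sym (ℕP.m+n∸m≡n k j))))
      where
      arith : ∀ k j → 2 *ℕ (k +ℕ j) +ℕ 1 ≡ k +ℕ (2 *ℕ j +ℕ 1) +ℕ k
      arith = ℕSolver.solve-∀

  term≋summand : ∀ k → k ≤ n → term n k ≋ (mono (N *ℕ n) ⊗ inv (q²q²Poch N)) ⊗ summand k
  term≋summand k k≤n = FPS.trans
    (⊗-congˡ (qint 1 (L k)) (⊗-congˡ (inv (q²q²Poch N)) (⊗-cong (FPS.sym (mono-+ (N *ℕ n) (3 *ℕ k))) (qYam≋ballot k k≤n))))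
    (shuffle (mono (N *ℕ n)) (mono (3 *ℕ k)) (ballot k) (inv (q²q²Poch N)) (qint 1 (L k)))
    where
    shuffle : ∀ x u y i s → ((x ⊗ u) ⊗ y ⊗ i) ⊗ s ≋ (x ⊗ i) ⊗ ((u ⊗ y) ⊗ s)
    shuffle = solve 5 (λ x u y i s → ((x :* u) :* y :* i) :* s := (x :* i) :* ((u :* y) :* s)) FPS.refl

  Σterm≋pairedEulerTerm : Σs (term n) (suc n) ≋ pairedEulerTerm n
  Σterm≋pairedEulerTerm = begin
    Σs (term n) (suc n)                          ≈⟨ ΣS.big-cong< (suc n) (λ k k<1+n → term≋summand k (ℕP.≤-pred k<1+n)) ⟩
    Σs (λ k → c ⊗ summand k) (suc n)             ≈⟨ ΣS.big-*ˡ c summand (suc n) ⟩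
    c ⊗ Σs summand (suc n)                       ≈⟨ ⊗-congʳ c Σsummand≋lhsPartial ⟩
    c ⊗ P                                        ≈⟨ ⊗-congˡ P (⊗-congʳ x (FPS.trans (inv-cong (ConstOne-q²q²Poch N) (q²q²Poch≋qqPoch⊗lhsPartial N)) (inv-⊗ (ConstOne-qqPoch N) (ConstOne-lhsPartial N)))) ⟩
    (x ⊗ (inv (qqPoch N) ⊗ inv P)) ⊗ P           ≈⟨ shuffle x (inv (qqPoch N)) (inv P) P ⟩
    (x ⊗ inv (qqPoch N)) ⊗ (inv P ⊗ P)           ≈⟨ ⊗-congʳ (x ⊗ inv (qqPoch N)) (inv-inverseˡ (ConstOne-lhsPartial N)) ⟩
    (x ⊗ inv (qqPoch N)) ⊗ one                   ≈⟨ FPS.*-identityʳ (x ⊗ inv (qqPoch N)) ⟩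
    x ⊗ inv (qqPoch N)                           ∎
    where
    open ≋-Reasoning
    x c P : FPS
    x = mono (N *ℕ n)
    c = x ⊗ inv (q²q²Poch N)
    P = lhsPartial N
    shuffle : ∀ x a b r → (x ⊗ (a ⊗ b)) ⊗ r ≋ (x ⊗ a) ⊗ (b ⊗ r)
    shuffle = solve 4 (λ x a b r → (x :* (a :* b)) :* r := (x :* a) :* (b :* r)) FPS.refl

infix 4 _≈[_]_
_≈[_]_ : FPS → ℕ → FPS → Set
a ≈[ r ] b = ∀ c → c ≤ r → a c ≡ b c

≋⇒≈[] : ∀ {a b} r → a ≋ b → a ≈[ r ] b
≋⇒≈[] r p c _ = p c

≈[]-trans : ∀ {a b c} r → a ≈[ r ] b → b ≈[ r ] c → a ≈[ r ] c
≈[]-trans r p q i i≤r = trans (p i i≤r) (q i i≤r)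

≈[]-⊗ : ∀ r {a a′ b b′} → a ≈[ r ] a′ → b ≈[ r ] b′ → a ⊗ b ≈[ r ] a′ ⊗ b′
≈[]-⊗ r {a} {a′} {b} {b′} p q c c≤r = begin
  (a ⊗ b) c                                ≡⟨ coeff-⊗ a b c ⟩
  ∑ℤ (λ i → a i * b (c ∸ i)) (suc c)       ≡⟨ ℤΣ.big-cong< (suc c) (λ i i<1+c → cong₂ _*_ (p i (ℕP.≤-trans (ℕP.≤-pred i<1+c) c≤r)) (q (c ∸ i) (ℕP.≤-trans (ℕP.m∸n≤m c i) c≤r))) ⟩
  ∑ℤ (λ i → a′ i * b′ (c ∸ i)) (suc c)     ≡⟨ sym (coeff-⊗ a′ b′ c) ⟩
  (a′ ⊗ b′) c                              ∎
  where open ≡.≡-Reasoning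

≈[]-Πs-one : ∀ r {f} m → (∀ i → f i ≈[ r ] one) → Πs f m ≈[ r ] one
≈[]-Πs-one r zero h = ≋⇒≈[] r FPS.refl
≈[]-Πs-one r (suc m) h = ≈[]-trans r (≈[]-⊗ r (h 0) (≈[]-Πs-one r m (λ i → h (suc i)))) (≋⇒≈[] r (⊗-identityˡ one))

mono-⊗-≈[] : ∀ r {a b} → a ≈[ r ] b → ∀ e c → c ≤ e +ℕ r → (mono e ⊗ a) c ≡ (mono e ⊗ b) c
mono-⊗-≈[] r {a} {b} p zero c c≤r = trans (⊗-identityˡ a c) (trans (p c c≤r) (sym (⊗-identityˡ b c)))
mono-⊗-≈[] r {a} {b} p (suc e) zero _ = trans (mono-suc-⊗ e a 0) (sym (mono-suc-⊗ e b 0))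
mono-⊗-≈[] r {a} {b} p (suc e) (suc c) (s≤s c≤e+r) = trans (mono-suc-⊗ e a (suc c)) (trans (mono-⊗-≈[] r p e c c≤e+r) (sym (mono-suc-⊗ e b (suc c))))

qfact-+ : ∀ d r m → qfact d (r +ℕ m) ≋ qfact d r ⊗ Πs (λ i → qint d (suc (r +ℕ i))) m
qfact-+ d r m = begin
  qfact d (r +ℕ m)                                              ≈⟨ qfact-Πs d (r +ℕ m) ⟩
  Πs (λ i → qint d (suc i)) (r +ℕ m)                            ≈⟨ ΠS.big-split (λ i → qint d (suc i)) r m ⟩
  Πs (λ i → qint d (suc i)) r ⊗ Πs (λ i → qint d (suc (r +ℕ i))) m ≈⟨ ⊗-congˡ (Πs (λ i → qint d (suc (r +ℕ i))) m) (FPS.sym (qfact-Πs d r)) ⟩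
  qfact d r ⊗ Πs (λ i → qint d (suc (r +ℕ i))) m                ∎
  where open ≋-Reasoning

oneMinusQ^ : ℕ → FPS
oneMinusQ^ m = Πs (λ _ → one ⊖ mono 1) m

qqPoch≋ : ∀ m → qqPoch m ≋ oneMinusQ^ m ⊗ qfact 1 m
qqPoch≋ m = begin
  qqPoch m                                                            ≈⟨ prodL-map-applyUpTo (λ j → one ⊖ mono 1 ⊗ mono (1 *ℕ j)) id m ⟩
  Πs (λ j → one ⊖ mono 1 ⊗ mono (1 *ℕ j)) m                           ≈⟨ ΠS.big-cong m (λ j → FPS.trans (⊖-congʳ one (mono-+ 1 (1 *ℕ j))) (FPS.sym (qint-geometric 1 (suc j)))) ⟩
  Πs (λ j → (one ⊖ mono 1) ⊗ qint 1 (suc j)) m                        ≈⟨ ΠS.big-∙ (λ _ → one ⊖ mono 1) (λ j → qint 1 (suc j)) m ⟩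
  oneMinusQ^ m ⊗ Πs (λ j → qint 1 (suc j)) m                          ≈⟨ ⊗-congʳ (oneMinusQ^ m) (FPS.sym (qfact-Πs 1 m)) ⟩
  oneMinusQ^ m ⊗ qfact 1 m                                            ∎
  where open ≋-Reasoning

shiftedPoch : ℕ → ℕ → FPS
shiftedPoch r m = Πs (λ i → one ⊖ mono (1 *ℕ suc (r +ℕ i))) m

shiftedPoch≋ : ∀ r m → shiftedPoch r m ≋ oneMinusQ^ m ⊗ Πs (λ i → qint 1 (suc (r +ℕ i))) m
shiftedPoch≋ r m = FPS.trans (ΠS.big-cong m (λ i → FPS.sym (qint-geometric 1 (suc (r +ℕ i)))))
  (ΠS.big-∙ (λ _ → one ⊖ mono 1) (λ i → qint 1 (suc (r +ℕ i))) m)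

qqPoch⊗qbin : ∀ m r → qqPoch m ⊗ qbin 1 (m +ℕ r) m ≋ shiftedPoch r m
qqPoch⊗qbin m r = ⊗-cancelʳ (qqPoch m ⊗ qbin 1 (m +ℕ r) m) (shiftedPoch r m) (ConstOne-qfact 0 r) (begin
  (qqPoch m ⊗ B) ⊗ qfact 1 r                   ≈⟨ ⊗-congˡ (qfact 1 r) (⊗-congˡ B (qqPoch≋ m)) ⟩
  ((oneMinusQ^ m ⊗ qfact 1 m) ⊗ B) ⊗ qfact 1 r  ≈⟨ shuffle (oneMinusQ^ m) (qfact 1 m) B (qfact 1 r) ⟩
  oneMinusQ^ m ⊗ ((qfact 1 m ⊗ qfact 1 r) ⊗ B)  ≈⟨ ⊗-congʳ (oneMinusQ^ m) (FPS.trans (qfact-qbin 1 m r) (FPS.trans (cong-≋ (qfact 1) (ℕP.+-comm m r)) (qfact-+ 1 r m))) ⟩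
  oneMinusQ^ m ⊗ (qfact 1 r ⊗ P)                ≈⟨ ⊗-Props.x∙yz≈xz∙y (oneMinusQ^ m) (qfact 1 r) P ⟩
  (oneMinusQ^ m ⊗ P) ⊗ qfact 1 r                ≈⟨ ⊗-congˡ (qfact 1 r) (FPS.sym (shiftedPoch≋ r m)) ⟩
  shiftedPoch r m ⊗ qfact 1 r                   ∎)
  where
  open ≋-Reasoning
  B P : FPS
  B = qbin 1 (m +ℕ r) m
  P = Πs (λ i → qint 1 (suc (r +ℕ i))) m
  shuffle : ∀ p f b g → ((p ⊗ f) ⊗ b) ⊗ g ≋ p ⊗ ((f ⊗ g) ⊗ b)
  shuffle = solve 4 (λ p f b g → ((p :* f) :* b) :* g := p :* ((f :* g) :* b)) FPS.refl

shiftedPoch≈[]one : ∀ r m → shiftedPoch r m ≈[ r ] one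
shiftedPoch≈[]one r m = ≈[]-Πs-one r m (λ i c c≤r → trans (cong (λ z → one c - z) (mono-below c (s≤s (ℕP.≤-trans c≤r (small i))))) (ℤP.+-identityʳ (one c)))
  where
  mono-below : ∀ {e} c → c < e → mono e c ≡ 0ℤ
  mono-below {e} c c<e = trans (sym (FPS.*-identityʳ (mono e) c)) (mono-⊗-below e one c c<e)
  small : ∀ i → r ≤ 1 *ℕ (r +ℕ i)
  small i = ℕP.≤-trans (ℕP.m≤m+n r i) (ℕP.≤-reflexive (sym (ℕP.*-identityˡ (r +ℕ i))))

inv-qqPoch≈[]qbin : ∀ m r → inv (qqPoch m) ≈[ r ] qbin 1 (m +ℕ r) m
inv-qqPoch≈[]qbin m r = ≈[]-trans r (≋⇒≈[] r (FPS.sym (FPS.*-identityʳ (inv (qqPoch m)))))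
  (≈[]-trans r (≈[]-⊗ r {inv (qqPoch m)} {inv (qqPoch m)} (λ _ _ → refl) (λ c c≤r → sym (shiftedPoch≈[]one r m c c≤r)))
  (≋⇒≈[] r (begin
    inv (qqPoch m) ⊗ shiftedPoch r m               ≈⟨ ⊗-congʳ (inv (qqPoch m)) (FPS.sym (qqPoch⊗qbin m r)) ⟩
    inv (qqPoch m) ⊗ (qqPoch m ⊗ B)                ≈⟨ FPS.sym (⊗-assoc (inv (qqPoch m)) (qqPoch m) B) ⟩
    (inv (qqPoch m) ⊗ qqPoch m) ⊗ B                ≈⟨ ⊗-congˡ B (inv-inverseˡ (ConstOne-qqPoch m)) ⟩
    one ⊗ B                                        ≈⟨ ⊗-identityˡ B ⟩
    B                                              ∎)))
  where
  open ≋-Reasoning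
  B : FPS
  B = qbin 1 (m +ℕ r) m

eulerTerm : ℕ → FPS
eulerTerm m = mono (tri m) ⊗ inv (qqPoch m)

-- q^T/(q;q)_m + q^(T+m+1)/(q;q)_(m+1) = q^T ((1 − q^(m+1)) + q^(m+1)) / (q;q)_(m+1).
eulerTerm-merge : ∀ m → eulerTerm m ⊕ eulerTerm (suc m) ≋ mono (tri m) ⊗ inv (qqPoch (suc m))
eulerTerm-merge m = ⊗-cancelʳ (eulerTerm m ⊕ eulerTerm (suc m)) (x ⊗ inv Q′) (ConstOne-qqPoch (suc m)) (begin
  (eulerTerm m ⊕ eulerTerm (suc m)) ⊗ Q′
    ≈⟨ FPS.distribʳ Q′ (eulerTerm m) (eulerTerm (suc m)) ⟩
  (x ⊗ inv Q) ⊗ Q′ ⊕ (mono (tri (suc m)) ⊗ inv Q′) ⊗ Q′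
    ≈⟨ ⊕-cong (FPS.trans (⊗-congʳ (x ⊗ inv Q) (poch-suc (mono 1) 1 m)) (FPS.trans (regroup x (inv Q) Q g) (⊗-cong (cancelled x (inv Q) Q (inv-inverseˡ (ConstOne-qqPoch m))) g≋)))
              (FPS.trans (cancelled (mono (tri (suc m))) (inv Q′) Q′ (inv-inverseˡ (ConstOne-qqPoch (suc m)))) (FPS.sym (mono-+ (tri m) (suc m)))) ⟩
  x ⊗ (one ⊖ mono (suc m)) ⊕ x ⊗ mono (suc m)
    ≈⟨ collapse x (mono (suc m)) ⟩
  x
    ≈⟨ FPS.sym (cancelled x (inv Q′) Q′ (inv-inverseˡ (ConstOne-qqPoch (suc m)))) ⟩
  (x ⊗ inv Q′) ⊗ Q′ ∎)
  where
  open ≋-Reasoning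
  x Q Q′ g : FPS
  x = mono (tri m)
  Q = qqPoch m
  Q′ = qqPoch (suc m)
  g = one ⊖ mono 1 ⊗ mono (1 *ℕ m)
  g≋ : g ≋ one ⊖ mono (suc m)
  g≋ = ⊖-congʳ one (FPS.trans (mono-+ 1 (1 *ℕ m)) (mono-cong (cong suc (ℕP.*-identityˡ m))))
  cancelled : ∀ y i p → i ⊗ p ≋ one → (y ⊗ i) ⊗ p ≋ y
  cancelled y i p e = FPS.trans (⊗-assoc y i p) (FPS.trans (⊗-congʳ y e) (FPS.*-identityʳ y))
  regroup : ∀ x i q g → (x ⊗ i) ⊗ (q ⊗ g) ≋ ((x ⊗ i) ⊗ q) ⊗ g
  regroup = solve 4 (λ x i q g → (x :* i) :* (q :* g) := ((x :* i) :* q) :* g) FPS.refl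
  collapse : ∀ x y → x ⊗ (one ⊖ y) ⊕ x ⊗ y ≋ x
  collapse = solve 2 (λ x y → x :* (con 1ℤ :- y) :+ x :* y := x) FPS.refl

tri-*2 : ∀ m → tri m *ℕ 2 ≡ m *ℕ suc m
tri-*2 zero = refl
tri-*2 (suc m) = trans (ℕP.*-distribʳ-+ 2 (tri m) (suc m)) (trans (cong (_+ℕ suc m *ℕ 2) (tri-*2 m)) (arith m))
  where
  arith : ∀ m → m *ℕ suc m +ℕ suc m *ℕ 2 ≡ suc m *ℕ suc (suc m)
  arith = ℕSolver.solve-∀

tri-double : ∀ n → tri (n +ℕ n) ≡ (2 *ℕ n +ℕ 1) *ℕ n
tri-double n = ℕP.*-cancelʳ-≡ (tri (n +ℕ n)) ((2 *ℕ n +ℕ 1) *ℕ n) 2 (trans (tri-*2 (n +ℕ n)) (arith n))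
  where
  arith : ∀ n → (n +ℕ n) *ℕ suc (n +ℕ n) ≡ (2 *ℕ n +ℕ 1) *ℕ n *ℕ 2
  arith = ℕSolver.solve-∀

m≤tri : ∀ m → m ≤ tri m
m≤tri zero = z≤n
m≤tri (suc m) = ℕP.m≤n+m (suc m) (tri m)

-- (-q;q)_M = Σ_m q^(m(m+1)/2) [M choose m]_q, and [M choose m]_q agrees with 1/(q;q)_m up to degree M − m.
lhsPartial≈[]ΣeulerTerm : ∀ M → lhsPartial M ≈[ M ] Σs eulerTerm (suc M)
lhsPartial≈[]ΣeulerTerm M c c≤M = begin
  lhsPartial M c                                          ≡⟨ sym (qbinSum-tri≋lhsPartial M c) ⟩
  qbinSum 1 tri M c                                       ≡⟨ coeff-Σs (λ m → mono (tri m) ⊗ qbin 1 M m) (suc M) c ⟩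
  ∑ℤ (λ m → (mono (tri m) ⊗ qbin 1 M m) c) (suc M)        ≡⟨ ℤΣ.big-cong< (suc M) (λ m m<1+M → truncated m (ℕP.≤-pred m<1+M)) ⟩
  ∑ℤ (λ m → eulerTerm m c) (suc M)                        ≡⟨ sym (coeff-Σs eulerTerm (suc M) c) ⟩
  Σs eulerTerm (suc M) c                                  ∎
  where
  open ≡.≡-Reasoning
  truncated : ∀ m → m ≤ M → (mono (tri m) ⊗ qbin 1 M m) c ≡ eulerTerm m c
  truncated m m≤M = trans (⊗-congʳ (mono (tri m)) (cong-≋ (λ j → qbin 1 j m) (sym M≡)) c)
    (sym (mono-⊗-≈[] (M ∸ m) (inv-qqPoch≈[]qbin m (M ∸ m)) (tri m) c
          (ℕP.≤-trans c≤M (ℕP.≤-trans (ℕP.≤-reflexive (sym M≡)) (ℕP.+-monoˡ-≤ (M ∸ m) (m≤tri m))))))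
    where
    M≡ : m +ℕ (M ∸ m) ≡ M
    M≡ = ℕP.m+[n∸m]≡n m≤M

ΣeulerTerm-extend : ∀ M K → Σs eulerTerm (suc M) ≈[ M ] Σs eulerTerm (suc M +ℕ K)
ΣeulerTerm-extend M K c c≤M = begin
  Σs eulerTerm (suc M) c                                                   ≡⟨ sym (ℤP.+-identityʳ _) ⟩
  Σs eulerTerm (suc M) c + 0ℤ                                              ≡⟨ cong (Σs eulerTerm (suc M) c +_) (sym tail-vanishes) ⟩
  Σs eulerTerm (suc M) c + Σs (λ i → eulerTerm (suc M +ℕ i)) K c           ≡⟨ sym (ΣS.big-split eulerTerm (suc M) K c) ⟩
  Σs eulerTerm (suc M +ℕ K) c                                              ∎
  where
  open ≡.≡-Reasoning
  tail-vanishes : Σs (λ i → eulerTerm (suc M +ℕ i)) K c ≡ 0ℤ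
  tail-vanishes = trans (coeff-Σs (λ i → eulerTerm (suc M +ℕ i)) K c)
    (ℤΣ.big-ε K (λ i → mono-⊗-below (tri (suc M +ℕ i)) (inv (qqPoch (suc M +ℕ i))) c
      (ℕP.≤-trans (s≤s c≤M) (ℕP.≤-trans (ℕP.m≤m+n (suc M) i) (m≤tri (suc M +ℕ i))))))

ΣeulerTerm-pairs : ∀ L → Σs eulerTerm (L +ℕ L) ≋ Σs pairedEulerTerm L
ΣeulerTerm-pairs L = FPS.trans (ΣS.big-pairs eulerTerm L) (ΣS.big-cong L (λ n → FPS.trans (eulerTerm-merge (n +ℕ n))
  (⊗-cong (mono-cong (tri-double n)) (cong-≋ (λ j → inv (qqPoch j)) (arith n)))))
  where
  arith : ∀ n → suc (n +ℕ n) ≡ 2 *ℕ n +ℕ 1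
  arith = ℕSolver.solve-∀

rhsPartial≋ΣpairedEulerTerm : ∀ M → rhsPartial M ≋ Σs pairedEulerTerm (suc M)
rhsPartial≋ΣpairedEulerTerm M = FPS.trans
  (sumL-map-applyUpTo (λ n → sumL (map (term n) (upTo (suc n)))) id (suc M))
  (ΣS.big-cong (suc M) (λ n → FPS.trans (sumL-map-applyUpTo (term n) id (suc n)) (Σterm≋pairedEulerTerm n)))

theorem3p34 : (N M : ℕ) → N ≤ M → lhsPartial M N ≡ rhsPartial M N
theorem3p34 N M N≤M = lhs≈[]rhs N N≤M
  where
  lhs≈[]rhs : lhsPartial M ≈[ M ] rhsPartial M
  lhs≈[]rhs = ≈[]-trans M (lhsPartial≈[]ΣeulerTerm M) (≈[]-trans M (ΣeulerTerm-extend M (suc M))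
    (≋⇒≈[] M (FPS.trans (ΣeulerTerm-pairs (suc M)) (FPS.sym (rhsPartial≋ΣpairedEulerTerm M)))))
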